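{- Let $Q$ be a prime power, let $n>0$ and $k\ge 0$ be integers, and let $\beta,\gamma\in\mathbb{F}_{Q^2}$ satisfy $\beta^{Q+1}=1$ and $\gamma^{Q+1}\ne 1$. Then the polynomial \[ f(x):=x^{n+k(Q+1)} \cdot\left( (\gamma x^{Q-1}-\beta)^n - \gamma (x^{Q-1}-\gamma^Q\beta)^n \right) \] permutes $\mathbb{F}_{Q^2}$ (i.e., the map $\alpha\mapsto f(\alpha)$ is a bijection of $\mathbb{F}_{Q^2}$) if and only if $\gcd(n+2k,Q-1)=1$ and $\gcd(n,Q+1)=1$. -}

module Defs where

open import Level using (Level; _⊔_) renaming (suc to lsuc)
open import Data.Nat using (ℕ; _≥_)
import Data.Nat as ℕ
open import Data.Nat.Primality using (Prime)
open import Data.Fin using (Fin)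
open import Data.Product using (_×_; ∃; Σ)
open import Relation.Nullary using (¬_)
open import Relation.Binary.PropositionalEquality using (_≡_)
open import Algebra.Bundles using (CommutativeRing; Semiring)
import Algebra.Definitions.RawSemiring as RawSemiringDefs

IsPrimePower : ℕ → Set
IsPrimePower Q = ∃ λ p → ∃ λ e → Prime p × e ≥ 1 × Q ≡ p ℕ.^ e

record FiniteField (c ℓ : Level) (N : ℕ) : Set (lsuc (c ⊔ ℓ)) where
  field
    commRing : CommutativeRing c ℓ
  open CommutativeRing commRing public
  open RawSemiringDefs (Semiring.rawSemiring semiring) public using () renaming (_^_ to _^ᶠ_)
  field
    1≉0       : ¬ (1# ≈ 0#)
    inverse   : ∀ x → ¬ (x ≈ 0#) → ∃ λ y → x * y ≈ 1#
    enum      : Fin N → Carrier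
    enum-surj : ∀ x → ∃ λ i → enum i ≈ x
    enum-inj  : ∀ i j → enum i ≈ enum j → i ≡ j

module _ {c ℓ N} (F : FiniteField c ℓ N) where
  open FiniteField F

  Permutes : (Carrier → Carrier) → Set (c ⊔ ℓ)
  Permutes f = (∀ a b → f a ≈ f b → a ≈ b) × (∀ y → ∃ λ x → f x ≈ y)

  fPoly : (Q n k : ℕ) (β γ : Carrier) → Carrier → Carrier
  fPoly Q n k β γ x =
    (x ^ᶠ (n ℕ.+ k ℕ.* (Q ℕ.+ 1))) *
      (((γ * (x ^ᶠ (Q ℕ.∸ 1))) + - β) ^ᶠ n
        + - (γ * (((x ^ᶠ (Q ℕ.∸ 1)) + - ((γ ^ᶠ Q) * β)) ^ᶠ n)))

-- Write q = Q - 1, σ x = x ^ Q and u = x ^ q; for x ≠ 0, u has norm σ u * u = 1, and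
-- f x = x ^ r * h u with r = n + k (Q + 1), h u = A u ^ n - γ B u ^ n, A u = γ u - β and
-- B u = u - σ γ β.  For u of norm one, (u β) σ (A u) = - B u and (u β) σ (B u) = - A u,
-- so (u β) ^ n σ (h u) = G u := (- B u) ^ n - σ γ (- A u) ^ n.
--
-- If f x₁ = f x₂, comparing f with σ ∘ f gives (A u₁ B u₂) ^ n = (A u₂ B u₁) ^ n.  Both
-- products have the same norm, so gcd (n, Q + 1) = 1 forces A u₁ B u₂ = A u₂ B u₁, a
-- relation that is linear in u₁, u₂ and gives u₁ = u₂.  Then x₁ ^ (n + 2k) = x₂ ^ (n + 2k)
-- and x₁ ^ q = x₂ ^ q, so x₁ = x₂ when gcd (n + 2k, q) = 1; an injective self-map of a
-- finite field is bijective.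
--
-- Conversely, a root of unity ζ ≠ 1 of order dividing gcd (n + 2k, q) has f ζ = f 1.  If
-- ζ ≠ 1 has order dividing gcd (n, Q + 1), then for v ∈ {1, ζ} the norm-one solution u_v
-- of A u = v B u is some x_v ^ q (Hilbert 90), and y = f x_v satisfies a relation between
-- σ y and y that does not depend on v.  So f x₁ / f x_ζ is a q-th root of unity, hence of
-- the form t ^ (n + 2k) with t ^ q = 1, and f (t x_ζ) = f x₁; injectivity would force
-- u₁ = u_ζ and thus ζ = 1.

module Submission where

open import Defs
open import Level using (Level; _⊔_)
open import Algebra.Bundles using (CommutativeRing; RawRing)
open import Algebra.Solver.Ring.AlmostCommutativeRing using (fromCommutativeRing; _-Raw-AlmostCommutative⟶_)
import Algebra.Properties.CommutativeMonoid.Sum as MonoidSum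
import Algebra.Properties.Semiring.Mult as SemiringMult
open import Data.Nat as ℕ using (ℕ; zero; suc; _∸_; _^_; _>_; z≤n; s≤s)
import Data.Nat.Properties as ℕ
open import Data.Nat.Combinatorics using (_C_; nC1≡n; nCn≡1; nCk+nC[k+1]≡[n+1]C[k+1])
open import Data.Nat.Divisibility using (_∣_; divides; ∣⇒≤; ∣-trans)
open import Data.Nat.Primality using (Prime; euclidsLemma; prime⇒nonTrivial)
open import Data.Nat.GCD using (gcd; gcd[m,n]∣m; gcd[m,n]∣n; gcd[m,n]≢0; gcd-GCD; module Bézout)
open import Data.Nat.Tactic.RingSolver using (solve-∀)
open import Data.Integer as ℤ using (ℤ; +_; -[1+_]; _⊖_)
import Data.Integer.Properties as ℤ
open import Data.Sign as Sign using (Sign)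
open import Data.Fin as Fin using (Fin; zero; suc; toℕ)
import Data.Fin.Properties as Fin
open import Data.Fin.Permutation using (Permutation; permutation; _⟨$⟩ʳ_)
open import Data.List using (List; []; _∷_; length; tabulate)
import Data.List.Properties as List
open import Data.List.Relation.Unary.Any using (Any; here; there)
open import Data.List.Relation.Unary.All using (All; []; _∷_)
open import Data.List.Relation.Unary.AllPairs using (AllPairs; []; _∷_)
import Data.List.Relation.Unary.All.Properties as All
import Data.List.Relation.Unary.AllPairs.Properties as AllPairs
open import Data.Maybe using (Maybe; just; nothing)
open import Data.Product using (_×_; _,_; proj₁; proj₂; ∃)
open import Data.Sum using (_⊎_; inj₁; inj₂)
open import Data.Empty using (⊥; ⊥-elim)
open import Function.Bundles using (_⇔_; mk⇔)
open import Relation.Nullary using (¬_; Dec; yes; no; ¬?)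
open import Relation.Binary.PropositionalEquality as ≡ using (_≡_; _≢_)

suc-*-C : ∀ n k → suc k ℕ.* (suc n C suc k) ≡ suc n ℕ.* (n C k)
suc-*-C zero    zero    = ≡.refl
suc-*-C zero    (suc k) = ℕ.*-zeroʳ (suc (suc k))
suc-*-C (suc n) zero    = ≡.trans (ℕ.*-identityˡ _) (≡.trans (nC1≡n (suc (suc n))) (≡.sym (ℕ.*-identityʳ _)))
suc-*-C (suc n) (suc k) = begin
  suc (suc k) ℕ.* (suc (suc n) C suc (suc k))
    ≡⟨ ≡.cong (suc (suc k) ℕ.*_) (≡.sym (nCk+nC[k+1]≡[n+1]C[k+1] (suc n) (suc k))) ⟩
  suc (suc k) ℕ.* (a ℕ.+ b)
    ≡⟨ ℕ.*-distribˡ-+ (suc (suc k)) a b ⟩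
  (a ℕ.+ suc k ℕ.* a) ℕ.+ suc (suc k) ℕ.* b
    ≡⟨ ≡.cong₂ (λ u v → (a ℕ.+ u) ℕ.+ v) (suc-*-C n k) (suc-*-C n (suc k)) ⟩
  (a ℕ.+ suc n ℕ.* (n C k)) ℕ.+ suc n ℕ.* (n C suc k)
    ≡⟨ ℕ.+-assoc a _ _ ⟩
  a ℕ.+ (suc n ℕ.* (n C k) ℕ.+ suc n ℕ.* (n C suc k))
    ≡⟨ ≡.cong (a ℕ.+_) (≡.sym (ℕ.*-distribˡ-+ (suc n) (n C k) (n C suc k))) ⟩
  a ℕ.+ suc n ℕ.* (n C k ℕ.+ n C suc k)
    ≡⟨ ≡.cong (λ c → a ℕ.+ suc n ℕ.* c) (nCk+nC[k+1]≡[n+1]C[k+1] n k) ⟩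
  suc (suc n) ℕ.* a ∎
  where
  open ≡.≡-Reasoning
  a = suc n C suc k
  b = suc n C suc (suc k)

prime∣C : ∀ {p} → Prime p → ∀ m → 0 ℕ.< m → m ℕ.< p → p ∣ p C m
prime∣C {suc n} p-prime (suc k) _ m<p
  with euclidsLemma (suc k) (suc n C suc k) p-prime
         (divides (n C k) (≡.trans (suc-*-C n k) (ℕ.*-comm (suc n) _)))
... | inj₂ p∣C = p∣C
... | inj₁ p∣m = ⊥-elim (ℕ.<⇒≱ m<p (∣⇒≤ p∣m))

gcd≢1⇒2≤gcd : ∀ a b → b ≢ 0 → gcd a b ≢ 1 → 2 ℕ.≤ gcd a b
gcd≢1⇒2≤gcd a b b≢0 g≢1 with gcd a b | gcd[m,n]≢0 a b (inj₂ b≢0)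
... | zero        | g≢0 = ⊥-elim (g≢0 ≡.refl)
... | suc zero    | _   = ⊥-elim (g≢1 ≡.refl)
... | suc (suc _) | _   = s≤s (s≤s z≤n)

-- The canonical map ℤ → R is a ring morphism; it lets the ring solver use
-- integer coefficients in an arbitrary commutative ring.
module IntegerSolver {c ℓ} (R : CommutativeRing c ℓ) where
  open CommutativeRing R
  open import Algebra.Properties.Ring ring using (-0#≈0#; -‿involutive; -‿distribˡ-*; -‿distribʳ-*; -‿+-comm)
  open import Algebra.Properties.Semiring.Mult.TCOptimised semiring using (1+×; ×-homo-+; ×1-homo-*) renaming (_×_ to _×ₙ_)
  open import Relation.Binary.Reasoning.Setoid setoid

  fromℤ : ℤ → Carrier
  fromℤ (+ n)    = n ×ₙ 1#
  fromℤ -[1+ n ] = - (suc n ×ₙ 1#)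

  fromℤ-⊖ : ∀ m n → fromℤ (m ⊖ n) ≈ m ×ₙ 1# + - (n ×ₙ 1#)
  fromℤ-⊖ zero    zero    = sym (trans (+-congˡ -0#≈0#) (+-identityʳ _))
  fromℤ-⊖ (suc m) zero    = sym (trans (+-congˡ -0#≈0#) (+-identityʳ _))
  fromℤ-⊖ zero    (suc n) = sym (+-identityˡ _)
  fromℤ-⊖ (suc m) (suc n) rewrite ℤ.[1+m]⊖[1+n]≡m⊖n m n = begin
    fromℤ (m ⊖ n)                          ≈⟨ fromℤ-⊖ m n ⟩
    m ×ₙ 1# + - (n ×ₙ 1#)                  ≈⟨ sym (+-identityˡ _) ⟩
    0# + (m ×ₙ 1# + - (n ×ₙ 1#))           ≈⟨ +-congʳ (sym (-‿inverseʳ 1#)) ⟩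
    (1# + - 1#) + (m ×ₙ 1# + - (n ×ₙ 1#))  ≈⟨ shuffle 1# (m ×ₙ 1#) (n ×ₙ 1#) ⟩
    (1# + m ×ₙ 1#) + - (1# + n ×ₙ 1#)      ≈⟨ sym (+-cong (1+× m 1#) (-‿cong (1+× n 1#))) ⟩
    suc m ×ₙ 1# + - (suc n ×ₙ 1#)          ∎
    where
    shuffle : ∀ a b d → (a + - a) + (b + - d) ≈ (a + b) + - (a + d)
    shuffle a b d = begin
      (a + - a) + (b + - d)  ≈⟨ +-assoc a (- a) _ ⟩
      a + (- a + (b + - d))  ≈⟨ +-congˡ (sym (+-assoc (- a) b (- d))) ⟩
      a + ((- a + b) + - d)  ≈⟨ +-congˡ (+-congʳ (+-comm (- a) b)) ⟩
      a + ((b + - a) + - d)  ≈⟨ +-congˡ (+-assoc b (- a) (- d)) ⟩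
      a + (b + (- a + - d))  ≈⟨ sym (+-assoc a b _) ⟩
      (a + b) + (- a + - d)  ≈⟨ +-congˡ (-‿+-comm a d) ⟩
      (a + b) + - (a + d)    ∎

  fromℤ-+ : ∀ i j → fromℤ (i ℤ.+ j) ≈ fromℤ i + fromℤ j
  fromℤ-+ (+ m)    (+ n)    = ×-homo-+ 1# m n
  fromℤ-+ (+ m)    -[1+ n ] = fromℤ-⊖ m (suc n)
  fromℤ-+ -[1+ m ] (+ n)    = trans (fromℤ-⊖ n (suc m)) (+-comm _ _)
  fromℤ-+ -[1+ m ] -[1+ n ] = begin
    - (suc (suc (m ℕ.+ n)) ×ₙ 1#)      ≈⟨ -‿cong (reflexive (≡.cong (λ j → suc j ×ₙ 1#) (≡.sym (ℕ.+-suc m n)))) ⟩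
    - ((suc m ℕ.+ suc n) ×ₙ 1#)        ≈⟨ -‿cong (×-homo-+ 1# (suc m) (suc n)) ⟩
    - (suc m ×ₙ 1# + suc n ×ₙ 1#)      ≈⟨ sym (-‿+-comm _ _) ⟩
    - (suc m ×ₙ 1#) + - (suc n ×ₙ 1#)  ∎

  signed : Sign → Carrier → Carrier
  signed Sign.+ x = x
  signed Sign.- x = - x

  signed-cong : ∀ s {a b} → a ≈ b → signed s a ≈ signed s b
  signed-cong Sign.+ a≈b = a≈b
  signed-cong Sign.- a≈b = -‿cong a≈b

  signed-* : ∀ s t a b → signed (s Sign.* t) (a * b) ≈ signed s a * signed t b
  signed-* Sign.+ Sign.+ a b = refl
  signed-* Sign.+ Sign.- a b = -‿distribʳ-* a b
  signed-* Sign.- Sign.+ a b = -‿distribˡ-* a b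
  signed-* Sign.- Sign.- a b = begin
    a * b        ≈⟨ sym (-‿involutive _) ⟩
    - - (a * b)  ≈⟨ -‿cong (-‿distribˡ-* a b) ⟩
    - (- a * b)  ≈⟨ -‿distribʳ-* (- a) b ⟩
    - a * - b    ∎

  fromℤ-◃ : ∀ s n → fromℤ (s ℤ.◃ n) ≈ signed s (n ×ₙ 1#)
  fromℤ-◃ Sign.+ zero    = refl
  fromℤ-◃ Sign.+ (suc n) = refl
  fromℤ-◃ Sign.- zero    = sym -0#≈0#
  fromℤ-◃ Sign.- (suc n) = refl

  fromℤ≈signed : ∀ i → fromℤ i ≈ signed (ℤ.sign i) (ℤ.∣ i ∣ ×ₙ 1#)
  fromℤ≈signed (+ n)    = refl
  fromℤ≈signed -[1+ n ] = refl

  fromℤ-* : ∀ i j → fromℤ (i ℤ.* j) ≈ fromℤ i * fromℤ j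
  fromℤ-* i j = begin
    fromℤ (i ℤ.* j)
      ≈⟨ fromℤ-◃ (ℤ.sign i Sign.* ℤ.sign j) (ℤ.∣ i ∣ ℕ.* ℤ.∣ j ∣) ⟩
    signed (ℤ.sign i Sign.* ℤ.sign j) ((ℤ.∣ i ∣ ℕ.* ℤ.∣ j ∣) ×ₙ 1#)
      ≈⟨ signed-cong (ℤ.sign i Sign.* ℤ.sign j) (×1-homo-* ℤ.∣ i ∣ ℤ.∣ j ∣) ⟩
    signed (ℤ.sign i Sign.* ℤ.sign j) ((ℤ.∣ i ∣ ×ₙ 1#) * (ℤ.∣ j ∣ ×ₙ 1#))
      ≈⟨ signed-* (ℤ.sign i) (ℤ.sign j) _ _ ⟩
    signed (ℤ.sign i) (ℤ.∣ i ∣ ×ₙ 1#) * signed (ℤ.sign j) (ℤ.∣ j ∣ ×ₙ 1#)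
      ≈⟨ sym (*-cong (fromℤ≈signed i) (fromℤ≈signed j)) ⟩
    fromℤ i * fromℤ j ∎

  fromℤ-neg : ∀ i → fromℤ (ℤ.- i) ≈ - fromℤ i
  fromℤ-neg (+ zero)  = sym -0#≈0#
  fromℤ-neg (+ suc n) = refl
  fromℤ-neg -[1+ n ]  = sym (-‿involutive _)

  ℤ-rawRing : RawRing _ _
  ℤ-rawRing = record
    { Carrier = ℤ ; _≈_ = _≡_ ; _+_ = ℤ._+_ ; _*_ = ℤ._*_ ; -_ = ℤ.-_ ; 0# = + 0 ; 1# = + 1 }

  ℤ⟶R : ℤ-rawRing -Raw-AlmostCommutative⟶ fromCommutativeRing R
  ℤ⟶R = record
    { ⟦_⟧ = fromℤ ; +-homo = fromℤ-+ ; *-homo = fromℤ-* ; -‿homo = fromℤ-neg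
    ; 0-homo = refl ; 1-homo = refl }

  fromℤ-≟ : ∀ i j → Maybe (fromℤ i ≈ fromℤ j)
  fromℤ-≟ i j with i ℤ.≟ j
  ... | yes ≡.refl = just refl
  ... | no _       = nothing

  open import Algebra.Solver.Ring ℤ-rawRing (fromCommutativeRing R) ℤ⟶R fromℤ-≟ public

module FiniteFieldProperties {c ℓ N} (F : FiniteField c ℓ N) where
  open FiniteField F public hiding (zero)
  open import Algebra.Properties.Ring ring public
    using (-0#≈0#; -‿involutive; -1*x≈-x; -‿distribʳ-*)
  open import Algebra.Properties.Group +-group public
    using () renaming (x∙y⁻¹≈ε⇒x≈y to x-y≈0⇒x≈y; identityˡ-unique to +-identityˡ-unique;
                       inverseʳ-unique to +-inverseʳ-unique)
  open import Algebra.Properties.Semiring.Exp semiring public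
    using (^-congˡ; ^-homo-*; ^-assocʳ)
  open import Algebra.Properties.CommutativeSemiring.Exp commutativeSemiring public
    using (^-distrib-*)
  open SemiringMult semiring public
    using (×1-homo-*; ×-assoc-*; ×-congʳ; ×-homo-1) renaming (_×_ to _×ₙ_)
  open IntegerSolver commRing public
    using (solve; _:=_; _:+_; _:*_; :-_; _:-_; con)
  open import Relation.Binary.Reasoning.Setoid setoid public
  module Σ+ = MonoidSum +-commutativeMonoid
  module Π* = MonoidSum *-commutativeMonoid

  x∙yz≈y∙xz : ∀ x y z → x * (y * z) ≈ y * (x * z)
  x∙yz≈y∙xz = solve 3 (λ x y z → x :* (y :* z) := y :* (x :* z)) refl

  index : Carrier → Fin N
  index x = proj₁ (enum-surj x)

  enum-index : ∀ x → enum (index x) ≈ x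
  enum-index x = proj₂ (enum-surj x)

  index-cong : ∀ {x y} → x ≈ y → index x ≡ index y
  index-cong {x} {y} x≈y = enum-inj _ _ (trans (enum-index x) (trans x≈y (sym (enum-index y))))

  index-injective : ∀ {x y} → index x ≡ index y → x ≈ y
  index-injective {x} {y} eq = trans (sym (enum-index x)) (trans (reflexive (≡.cong enum eq)) (enum-index y))

  2≤N : 2 ℕ.≤ N
  2≤N = Fin.injective⇒≤ {f = zeroOrOne} zeroOrOne-injective
    where
    zeroOrOne : Fin 2 → Fin N
    zeroOrOne zero    = index 0#
    zeroOrOne (suc _) = index 1#
    zeroOrOne-injective : ∀ {i j} → zeroOrOne i ≡ zeroOrOne j → i ≡ j
    zeroOrOne-injective {zero}     {zero}     _  = ≡.refl
    zeroOrOne-injective {zero}     {suc zero} eq = ⊥-elim (1≉0 (sym (index-injective eq)))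
    zeroOrOne-injective {suc zero} {zero}     eq = ⊥-elim (1≉0 (index-injective eq))
    zeroOrOne-injective {suc zero} {suc zero} _  = ≡.refl

  0<N : 0 ℕ.< N
  0<N = ℕ.<-trans (s≤s z≤n) 2≤N

  infix 4 _≟_
  _≟_ : ∀ x y → Dec (x ≈ y)
  x ≟ y with index x Fin.≟ index y
  ... | yes eq = yes (index-injective eq)
  ... | no neq = no (λ x≈y → neq (index-cong x≈y))

  _⁻¹⟨_⟩ : ∀ x → x ≉ 0# → Carrier
  x ⁻¹⟨ x≉0 ⟩ = proj₁ (inverse x x≉0)

  x*x⁻¹≈1 : ∀ x (x≉0 : x ≉ 0#) → x * x ⁻¹⟨ x≉0 ⟩ ≈ 1#
  x*x⁻¹≈1 x x≉0 = proj₂ (inverse x x≉0)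

  x*y≈0⇒y≈0 : ∀ {x y} → x ≉ 0# → x * y ≈ 0# → y ≈ 0#
  x*y≈0⇒y≈0 {x} {y} x≉0 xy≈0 = begin
    y                      ≈⟨ sym (*-identityˡ y) ⟩
    1# * y                 ≈⟨ *-congʳ (sym (trans (*-comm _ x) (x*x⁻¹≈1 x x≉0))) ⟩
    (x ⁻¹⟨ x≉0 ⟩ * x) * y  ≈⟨ *-assoc _ x y ⟩
    x ⁻¹⟨ x≉0 ⟩ * (x * y)  ≈⟨ *-congˡ xy≈0 ⟩
    x ⁻¹⟨ x≉0 ⟩ * 0#       ≈⟨ zeroʳ _ ⟩
    0#                     ∎

  *-nonzero : ∀ {x y} → x ≉ 0# → y ≉ 0# → x * y ≉ 0#
  *-nonzero x≉0 y≉0 xy≈0 = y≉0 (x*y≈0⇒y≈0 x≉0 xy≈0)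

  ^-nonzero : ∀ {x} m → x ≉ 0# → x ^ᶠ m ≉ 0#
  ^-nonzero zero    x≉0 = 1≉0
  ^-nonzero (suc m) x≉0 = *-nonzero x≉0 (^-nonzero m x≉0)

  -‿nonzero : ∀ {x} → x ≉ 0# → - x ≉ 0#
  -‿nonzero {x} x≉0 -x≈0 = x≉0 (begin
    x      ≈⟨ sym (-‿involutive x) ⟩
    - - x  ≈⟨ -‿cong -x≈0 ⟩
    - 0#   ≈⟨ -0#≈0# ⟩
    0#     ∎)

  *-cancelˡ : ∀ {x a b} → x ≉ 0# → x * a ≈ x * b → a ≈ b
  *-cancelˡ {x} {a} {b} x≉0 xa≈xb = x-y≈0⇒x≈y a b (x*y≈0⇒y≈0 x≉0 (begin
    x * (a + - b)      ≈⟨ *-distrib-minus x a b ⟩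
    x * a + - (x * b)  ≈⟨ +-congʳ xa≈xb ⟩
    x * b + - (x * b)  ≈⟨ -‿inverseʳ _ ⟩
    0#                 ∎))
    where
    *-distrib-minus : ∀ x a b → x * (a + - b) ≈ x * a + - (x * b)
    *-distrib-minus = solve 3 (λ x a b → x :* (a :- b) := x :* a :- x :* b) refl

  *-cancelʳ : ∀ {x a b} → x ≉ 0# → a * x ≈ b * x → a ≈ b
  *-cancelʳ {x} {a} {b} x≉0 ax≈bx = *-cancelˡ x≉0 (trans (*-comm x a) (trans ax≈bx (*-comm b x)))

  1^m≈1 : ∀ m → 1# ^ᶠ m ≈ 1#
  1^m≈1 zero    = refl
  1^m≈1 (suc m) = trans (*-identityˡ _) (1^m≈1 m)

  0^m≈0 : ∀ {m} → 0 ℕ.< m → 0# ^ᶠ m ≈ 0#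
  0^m≈0 {suc m} _ = zeroˡ _

  ^-comm : ∀ x m n → (x ^ᶠ m) ^ᶠ n ≈ (x ^ᶠ n) ^ᶠ m
  ^-comm x m n = begin
    (x ^ᶠ m) ^ᶠ n  ≈⟨ ^-assocʳ x m n ⟩
    x ^ᶠ (m ℕ.* n) ≡⟨ ≡.cong (x ^ᶠ_) (ℕ.*-comm m n) ⟩
    x ^ᶠ (n ℕ.* m) ≈⟨ sym (^-assocʳ x n m) ⟩
    (x ^ᶠ n) ^ᶠ m  ∎

  ^-*-comm : ∀ x m n → x ^ᶠ (m ℕ.* n) ≈ (x ^ᶠ n) ^ᶠ m
  ^-*-comm x m n = trans (sym (^-assocʳ x m n)) (^-comm x m n)

  x^s≈1⇒[x*y]^s≈y^s : ∀ {x} y s → x ^ᶠ s ≈ 1# → (x * y) ^ᶠ s ≈ y ^ᶠ s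
  x^s≈1⇒[x*y]^s≈y^s {x} y s x^s≈1 = trans (^-distrib-* x y s) (trans (*-congʳ x^s≈1) (*-identityˡ _))

  x^s≈1⇒[x^j]^s≈1 : ∀ {x} j s → x ^ᶠ s ≈ 1# → (x ^ᶠ j) ^ᶠ s ≈ 1#
  x^s≈1⇒[x^j]^s≈1 {x} j s x^s≈1 = trans (^-comm x j s) (trans (^-congˡ j x^s≈1) (1^m≈1 j))

  x^d≈1⇒x^md≈1 : ∀ {x} d a → x ^ᶠ d ≈ 1# → d ∣ a → x ^ᶠ a ≈ 1#
  x^d≈1⇒x^md≈1 {x} d a x^d≈1 (divides j ≡.refl) =
    trans (^-*-comm x j d) (trans (^-congˡ j x^d≈1) (1^m≈1 j))

  fin-injective⇒surjective : ∀ {n} (h : Fin n → Fin n) → (∀ {i j} → h i ≡ h j → i ≡ j)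
                           → ∀ j → ∃ λ i → h i ≡ j
  fin-injective⇒surjective {suc m} h h-inj j with Fin.any? (λ i → h i Fin.≟ j)
  ... | yes hit = hit
  ... | no miss = ⊥-elim (ℕ.<-irrefl ≡.refl (Fin.injective⇒≤ punched-injective))
    where
    punched : Fin (suc m) → Fin m
    punched i = Fin.punchOut {i = j} (λ eq → miss (i , ≡.sym eq))
    punched-injective : ∀ {i i′} → punched i ≡ punched i′ → i ≡ i′
    punched-injective {i} {i′} eq = h-inj (Fin.punchOut-injective {i = j}
      (λ eq₁ → miss (i , ≡.sym eq₁)) (λ eq₁ → miss (i′ , ≡.sym eq₁)) eq)

  injective⇒surjective : (f : Carrier → Carrier) → (∀ a b → f a ≈ f b → a ≈ b)
                       → ∀ y → ∃ λ x → f x ≈ y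
  injective⇒surjective f f-inj y
    with fin-injective⇒surjective (λ i → index (f (enum i)))
           (λ {i} {j} eq → enum-inj i j (f-inj _ _ (index-injective eq))) (index y)
  ... | i , eq = enum i , index-injective eq

  bijection⇒permutation : (t t⁻¹ : Carrier → Carrier)
    → (∀ {a b} → a ≈ b → t a ≈ t b) → (∀ {a b} → a ≈ b → t⁻¹ a ≈ t⁻¹ b)
    → (∀ y → t (t⁻¹ y) ≈ y) → (∀ y → t⁻¹ (t y) ≈ y) → Permutation N N
  bijection⇒permutation t t⁻¹ t-cong t⁻¹-cong t∘t⁻¹ t⁻¹∘t =
    permutation (λ i → index (t (enum i))) (λ i → index (t⁻¹ (enum i)))
      (λ y → enum-inj _ y (trans (enum-index _) (trans (t-cong (enum-index _)) (t∘t⁻¹ (enum y)))))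
      (λ y → enum-inj _ y (trans (enum-index _) (trans (t⁻¹-cong (enum-index _)) (t⁻¹∘t (enum y)))))

  -- Translation by x permutes F, so adding x to every summand leaves Σ F unchanged.
  N×x≈0 : ∀ x → N ×ₙ x ≈ 0#
  N×x≈0 x = +-identityˡ-unique (N ×ₙ x) S shifted-sum
    where
    S = Σ+.sum enum
    translation = bijection⇒permutation (λ y → x + y) (λ y → - x + y) +-congˡ +-congˡ
      (λ y → trans (sym (+-assoc _ _ _)) (trans (+-congʳ (-‿inverseʳ x)) (+-identityˡ y)))
      (λ y → trans (sym (+-assoc _ _ _)) (trans (+-congʳ (-‿inverseˡ x)) (+-identityˡ y)))
    shifted-sum : N ×ₙ x + S ≈ S
    shifted-sum = begin
      N ×ₙ x + S                                ≈⟨ +-congʳ (sym (Σ+.sum-replicate N)) ⟩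
      Σ+.sum {N} (λ _ → x) + S                  ≈⟨ sym (Σ+.∑-distrib-+ {N} (λ _ → x) enum) ⟩
      Σ+.sum (λ i → x + enum i)                 ≈⟨ sym (Σ+.sum-cong-≋ (λ i → enum-index (x + enum i))) ⟩
      Σ+.sum (λ i → enum (translation ⟨$⟩ʳ i))  ≈⟨ sym (Σ+.sum-permute enum translation) ⟩
      S                                         ∎

  characteristic : ∀ p m → N ≡ p ^ m → p ×ₙ 1# ≈ 0#
  characteristic p m N≡p^m with p ×ₙ 1# ≟ 0#
  ... | yes p≈0 = p≈0
  ... | no  p≉0 = ⊥-elim (^-nonzero m p≉0 (begin
    (p ×ₙ 1#) ^ᶠ m  ≈⟨ sym (×1-^ m) ⟩
    (p ^ m) ×ₙ 1#   ≡⟨ ≡.cong (_×ₙ 1#) (≡.sym N≡p^m) ⟩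
    N ×ₙ 1#         ≈⟨ N×x≈0 1# ⟩
    0#              ∎))
    where
    ×1-^ : ∀ e → (p ^ e) ×ₙ 1# ≈ (p ×ₙ 1#) ^ᶠ e
    ×1-^ zero    = +-identityʳ 1#
    ×1-^ (suc e) = trans (×1-homo-* p (p ^ e)) (*-congˡ (×1-^ e))

  Π-nonzero : ∀ {n} (t : Fin n → Carrier) → (∀ i → t i ≉ 0#) → Π*.sum t ≉ 0#
  Π-nonzero {zero}  t t≉0 = 1≉0
  Π-nonzero {suc n} t t≉0 = *-nonzero (t≉0 zero) (Π-nonzero (λ i → t (suc i)) (λ i → t≉0 (suc i)))

  Π-update : ∀ {n} x (f g : Fin n → Carrier) (i : Fin n) → f i ≈ x * g i
           → (∀ j → j ≢ i → f j ≈ g j) → Π*.sum f ≈ x * Π*.sum g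
  Π-update {suc n} x f g i fi≈xgi fj≈gj = begin
    Π*.sum f                                        ≈⟨ Π*.sum-remove {i = i} f ⟩
    f i * Π*.sum (λ j → f (Fin.punchIn i j))        ≈⟨ *-cong fi≈xgi (Π*.sum-cong-≋ fj≈gj′) ⟩
    (x * g i) * Π*.sum (λ j → g (Fin.punchIn i j))  ≈⟨ *-assoc _ _ _ ⟩
    x * (g i * Π*.sum (λ j → g (Fin.punchIn i j)))  ≈⟨ *-congˡ (sym (Π*.sum-remove {i = i} g)) ⟩
    x * Π*.sum g                                    ∎
    where
    fj≈gj′ : ∀ j → f (Fin.punchIn i j) ≈ g (Fin.punchIn i j)
    fj≈gj′ j = fj≈gj (Fin.punchIn i j) (Fin.punchInᵢ≢i i j)

  zeroToOne : Carrier → Carrier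
  zeroToOne y with y ≟ 0#
  ... | yes _ = 1#
  ... | no  _ = y

  zeroToOne-nonzero : ∀ y → zeroToOne y ≉ 0#
  zeroToOne-nonzero y with y ≟ 0#
  ... | yes _   = 1≉0
  ... | no  y≉0 = y≉0

  zeroToOne-zero : ∀ {y} → y ≈ 0# → zeroToOne y ≈ 1#
  zeroToOne-zero {y} y≈0 with y ≟ 0#
  ... | yes _   = refl
  ... | no  y≉0 = ⊥-elim (y≉0 y≈0)

  zeroToOne-nonzero-id : ∀ {y} → y ≉ 0# → zeroToOne y ≈ y
  zeroToOne-nonzero-id {y} y≉0 with y ≟ 0#
  ... | yes y≈0 = ⊥-elim (y≉0 y≈0)
  ... | no  _   = refl

  zeroToOne-cong : ∀ {a b} → a ≈ b → zeroToOne a ≈ zeroToOne b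
  zeroToOne-cong {a} {b} a≈b with a ≟ 0# | b ≟ 0#
  ... | yes _   | yes _   = refl
  ... | yes a≈0 | no  b≉0 = ⊥-elim (b≉0 (trans (sym a≈b) a≈0))
  ... | no  a≉0 | yes b≈0 = ⊥-elim (a≉0 (trans a≈b b≈0))
  ... | no  _   | no  _   = a≈b

  -- The product P of all elements with 0 replaced by 1 is invariant under
  -- scaling by x ≉ 0, except at the zero element: x ^ N * P ≈ x * P.
  fermat : ∀ x → x ^ᶠ N ≈ x
  fermat x with x ≟ 0#
  ... | yes x≈0 = trans (^-congˡ N x≈0) (trans (0^m≈0 0<N) (sym x≈0))
  ... | no  x≉0 = *-cancelʳ (Π-nonzero P-factor (λ i → zeroToOne-nonzero _)) (begin
    x ^ᶠ N * P                          ≈⟨ *-congʳ (sym (Π*.sum-replicate N)) ⟩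
    Π*.sum {N} (λ _ → x) * P            ≈⟨ sym (Π*.∑-distrib-+ {N} (λ _ → x) P-factor) ⟩
    Π*.sum (λ i → x * P-factor i)       ≈⟨ Π-update x _ _ z scaled-zero scaled-nonzero ⟩
    x * Π*.sum (λ i → zeroToOne (x * enum i))
      ≈⟨ *-congˡ (Π*.sum-cong-≋ (λ i → zeroToOne-cong (sym (enum-index (x * enum i))))) ⟩
    x * Π*.sum (λ i → P-factor (scaling ⟨$⟩ʳ i))
      ≈⟨ *-congˡ (sym (Π*.sum-permute P-factor scaling)) ⟩
    x * P                               ∎)
    where
    P-factor : Fin N → Carrier
    P-factor i = zeroToOne (enum i)
    P = Π*.sum P-factor
    x⁻¹ = x ⁻¹⟨ x≉0 ⟩
    scaling = bijection⇒permutation (x *_) (x⁻¹ *_) *-congˡ *-congˡ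
      (λ y → trans (sym (*-assoc _ _ _)) (trans (*-congʳ (x*x⁻¹≈1 x x≉0)) (*-identityˡ y)))
      (λ y → trans (sym (*-assoc _ _ _)) (trans (*-congʳ (trans (*-comm _ _) (x*x⁻¹≈1 x x≉0))) (*-identityˡ y)))
    z = index 0#
    scaled-zero : x * P-factor z ≈ x * zeroToOne (x * enum z)
    scaled-zero = *-congˡ (trans (zeroToOne-zero (enum-index 0#))
      (sym (zeroToOne-zero (trans (*-congˡ (enum-index 0#)) (zeroʳ x)))))
    scaled-nonzero : ∀ j → j ≢ z → x * P-factor j ≈ zeroToOne (x * enum j)
    scaled-nonzero j j≢z = trans (*-congˡ (zeroToOne-nonzero-id e≉0)) (sym (zeroToOne-nonzero-id (*-nonzero x≉0 e≉0)))
      where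
      e≉0 : enum j ≉ 0#
      e≉0 e≈0 = j≢z (enum-inj _ _ (trans e≈0 (sym (enum-index 0#))))

  -- Polynomials are coefficient lists, constant coefficient first.
  eval : List Carrier → Carrier → Carrier
  eval []       x = 0#
  eval (c ∷ cs) x = c + x * eval cs x

  divide : List Carrier → Carrier → List Carrier
  divide []           a = []
  divide (c ∷ [])     a = []
  divide (c ∷ d ∷ cs) a = eval (d ∷ cs) a ∷ divide (d ∷ cs) a

  eval-divide : ∀ cs a x → eval cs x ≈ (x + - a) * eval (divide cs a) x + eval cs a
  eval-divide []       a x = sym (trans (+-identityʳ _) (zeroʳ _))
  eval-divide (c ∷ []) a x = constant c x a
    where
    constant : ∀ c x a → c + x * 0# ≈ (x + - a) * 0# + (c + a * 0#)
    constant = solve 3 (λ c x a → c :+ x :* con (+ 0) := (x :- a) :* con (+ 0) :+ (c :+ a :* con (+ 0))) refl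
  eval-divide (c ∷ cs@(_ ∷ _)) a x = begin
    c + x * eval cs x                                    ≈⟨ +-congˡ (*-congˡ (eval-divide cs a x)) ⟩
    c + x * ((x + - a) * eval (divide cs a) x + eval cs a) ≈⟨ horner c x a (eval (divide cs a) x) (eval cs a) ⟩
    (x + - a) * (eval cs a + x * eval (divide cs a) x) + (c + a * eval cs a) ∎
    where
    horner : ∀ c x a q r → c + x * ((x + - a) * q + r) ≈ (x + - a) * (r + x * q) + (c + a * r)
    horner = solve 5 (λ c x a q r → c :+ x :* ((x :- a) :* q :+ r) := (x :- a) :* (r :+ x :* q) :+ (c :+ a :* r)) refl

  length-divide : ∀ cs a → length (divide cs a) ≡ ℕ.pred (length cs)
  length-divide []           a = ≡.refl
  length-divide (c ∷ [])     a = ≡.refl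
  length-divide (c ∷ d ∷ cs) a = ≡.cong suc (length-divide (d ∷ cs) a)

  NonZeroPoly : List Carrier → Set (c ⊔ ℓ)
  NonZeroPoly = Any (_≉ 0#)

  nonZero⊎allZero : ∀ cs → NonZeroPoly cs ⊎ All (_≈ 0#) cs
  nonZero⊎allZero []       = inj₂ []
  nonZero⊎allZero (c ∷ cs) with c ≟ 0# | nonZero⊎allZero cs
  ... | no  c≉0 | _          = inj₁ (here c≉0)
  ... | yes _   | inj₁ nz    = inj₁ (there nz)
  ... | yes c≈0 | inj₂ zeros = inj₂ (c≈0 ∷ zeros)

  nonZero∧allZero⇒⊥ : ∀ {cs} → NonZeroPoly cs → All (_≈ 0#) cs → ⊥
  nonZero∧allZero⇒⊥ (here c≉0) (c≈0 ∷ _)  = c≉0 c≈0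
  nonZero∧allZero⇒⊥ (there nz) (_ ∷ zeros) = nonZero∧allZero⇒⊥ nz zeros

  divide-allZero : ∀ cs a → All (_≈ 0#) (divide cs a) → eval cs a ≈ 0# → All (_≈ 0#) cs
  divide-allZero []               a _                 _    = []
  divide-allZero (c ∷ [])         a []                ca≈0 = trans (sym (trans (+-congˡ (zeroʳ a)) (+-identityʳ c))) ca≈0 ∷ []
  divide-allZero (c ∷ cs@(_ ∷ _)) a (csa≈0 ∷ zeros) ca≈0 = c≈0 ∷ divide-allZero cs a zeros csa≈0
    where
    c≈0 : c ≈ 0#
    c≈0 = begin
      c                  ≈⟨ sym (+-identityʳ c) ⟩
      c + 0#             ≈⟨ +-congˡ (sym (zeroʳ a)) ⟩
      c + a * 0#         ≈⟨ +-congˡ (*-congˡ (sym csa≈0)) ⟩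
      c + a * eval cs a  ≈⟨ ca≈0 ⟩
      0#                 ∎

  divide-nonZero : ∀ cs a → NonZeroPoly cs → eval cs a ≈ 0# → NonZeroPoly (divide cs a)
  divide-nonZero cs a nz ca≈0 with nonZero⊎allZero (divide cs a)
  ... | inj₁ nz′  = nz′
  ... | inj₂ zeros = ⊥-elim (nonZero∧allZero⇒⊥ nz (divide-allZero cs a zeros ca≈0))

  nonZero⇒length>0 : ∀ {cs} → NonZeroPoly cs → 0 ℕ.< length cs
  nonZero⇒length>0 (here _)  = s≤s z≤n
  nonZero⇒length>0 (there _) = s≤s z≤n

  roots<length : ∀ cs → NonZeroPoly cs → (as : List Carrier) → AllPairs _≉_ as
               → All (λ a → eval cs a ≈ 0#) as → length as ℕ.< length cs
  roots<length cs nz []       _              _             = nonZero⇒length>0 nz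
  roots<length cs nz (a ∷ as) (a≉as ∷ as-distinct) (ca≈0 ∷ roots) =
    ≡.subst (λ L → suc (length as) ℕ.< L) (ℕ.suc-pred (length cs) {{ℕ.>-nonZero (nonZero⇒length>0 nz)}})
      (s≤s (≡.subst (length as ℕ.<_) (length-divide cs a)
        (roots<length (divide cs a) (divide-nonZero cs a nz ca≈0) as as-distinct (rootsOfQuotient as a≉as roots))))
    where
    rootsOfQuotient : ∀ bs → All (a ≉_) bs → All (λ b → eval cs b ≈ 0#) bs
                    → All (λ b → eval (divide cs a) b ≈ 0#) bs
    rootsOfQuotient []       _              _              = []
    rootsOfQuotient (b ∷ bs) (a≉b ∷ a≉bs) (cb≈0 ∷ cbs≈0) =
      x*y≈0⇒y≈0 b-a≉0 (begin
        (b + - a) * eval (divide cs a) b              ≈⟨ sym (+-identityʳ _) ⟩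
        (b + - a) * eval (divide cs a) b + 0#         ≈⟨ +-congˡ (sym ca≈0) ⟩
        (b + - a) * eval (divide cs a) b + eval cs a  ≈⟨ sym (eval-divide cs a b) ⟩
        eval cs b                                     ≈⟨ cb≈0 ⟩
        0#                                            ∎)
      ∷ rootsOfQuotient bs a≉bs cbs≈0
      where
      b-a≉0 : b + - a ≉ 0#
      b-a≉0 b-a≈0 = a≉b (sym (x-y≈0⇒x≈y b a b-a≈0))

  ∃-nonRoot : ∀ cs → NonZeroPoly cs → length cs ℕ.≤ N → ∃ λ x → eval cs x ≉ 0#
  ∃-nonRoot cs nz len≤N with Fin.any? (λ i → ¬? (eval cs (enum i) ≟ 0#))
  ... | yes (i , ci≉0) = enum i , ci≉0
  ... | no  noNonRoot  = ⊥-elim (ℕ.<-irrefl ≡.refl (ℕ.<-≤-trans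
          (≡.subst (ℕ._< length cs) (List.length-tabulate enum)
             (roots<length cs nz (tabulate enum)
               (AllPairs.tabulate⁺ (λ {i} {j} i≢j ei≈ej → i≢j (enum-inj i j ei≈ej)))
               (All.tabulate⁺ allRoots)))
          len≤N))
    where
    allRoots : ∀ i → eval cs (enum i) ≈ 0#
    allRoots i with eval cs (enum i) ≟ 0#
    ... | yes ci≈0 = ci≈0
    ... | no  ci≉0 = ⊥-elim (noNonRoot (i , ci≉0))

  monomial : ℕ → Carrier → List Carrier
  monomial zero    a = a ∷ []
  monomial (suc j) a = 0# ∷ monomial j a

  eval-monomial : ∀ j a x → eval (monomial j a) x ≈ a * x ^ᶠ j
  eval-monomial zero    a x = trans (+-congˡ (zeroʳ x)) (trans (+-identityʳ a) (sym (*-identityʳ a)))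
  eval-monomial (suc j) a x = begin
    0# + x * eval (monomial j a) x  ≈⟨ +-identityˡ _ ⟩
    x * eval (monomial j a) x       ≈⟨ *-congˡ (eval-monomial j a x) ⟩
    x * (a * x ^ᶠ j)                ≈⟨ x∙yz≈y∙xz x a (x ^ᶠ j) ⟩
    a * (x * x ^ᶠ j)                ∎

  length-monomial : ∀ j a → length (monomial j a) ≡ suc j
  length-monomial zero    a = ≡.refl
  length-monomial (suc j) a = ≡.cong suc (length-monomial j a)

  ∃-nonRoot-binomial : ∀ m a b → b ≉ 0# → 3 ℕ.+ m ℕ.≤ N
                     → ∃ λ x → x * (b + a * x ^ᶠ suc m) ≉ 0#
  ∃-nonRoot-binomial m a b b≉0 3+m≤N = nonRootFrom (∃-nonRoot cs (there (here b≉0)) len≤N)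
    where
    cs = 0# ∷ b ∷ monomial m a
    len≤N : length cs ℕ.≤ N
    len≤N = ≡.subst (ℕ._≤ N) (≡.sym (≡.cong (λ L → suc (suc L)) (length-monomial m a))) 3+m≤N
    eval-cs : ∀ x → eval cs x ≈ x * (b + a * x ^ᶠ suc m)
    eval-cs x = begin
      0# + x * (b + x * eval (monomial m a) x) ≈⟨ +-identityˡ _ ⟩
      x * (b + x * eval (monomial m a) x)      ≈⟨ *-congˡ (+-congˡ (*-congˡ (eval-monomial m a x))) ⟩
      x * (b + x * (a * x ^ᶠ m))               ≈⟨ *-congˡ (+-congˡ (x∙yz≈y∙xz x a (x ^ᶠ m))) ⟩
      x * (b + a * x ^ᶠ suc m)                 ∎
    nonRootFrom : (∃ λ x → eval cs x ≉ 0#) → ∃ λ x → x * (b + a * x ^ᶠ suc m) ≉ 0#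
    nonRootFrom (x , csx≉0) = x , λ px≈0 → csx≉0 (trans (eval-cs x) px≈0)

  1+[N-1]≡N : suc (N ∸ 1) ≡ N
  1+[N-1]≡N = ℕ.suc-pred N {{ℕ.>-nonZero 0<N}}

  x^[N-1]≈1 : ∀ {x} → x ≉ 0# → x ^ᶠ (N ∸ 1) ≈ 1#
  x^[N-1]≈1 {x} x≉0 = *-cancelˡ x≉0 (begin
    x * x ^ᶠ (N ∸ 1)  ≡⟨ ≡.cong (x ^ᶠ_) 1+[N-1]≡N ⟩
    x ^ᶠ N            ≈⟨ fermat x ⟩
    x                 ≈⟨ sym (*-identityʳ x) ⟩
    x * 1#            ∎)

  ∃-rootOfUnity : ∀ d → 2 ℕ.≤ d → d ∣ N ∸ 1 → ∃ λ ζ → ζ ^ᶠ d ≈ 1# × ζ ≉ 1#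
  ∃-rootOfUnity d 2≤d (divides zero N-1≡0) =
    ⊥-elim (ℕ.<-irrefl ≡.refl (ℕ.≤-trans 2≤N (ℕ.≤-reflexive (≡.trans (≡.sym 1+[N-1]≡N) (≡.cong suc N-1≡0)))))
  ∃-rootOfUnity d 2≤d (divides (suc m) N-1≡[1+m]d) =
    rootFrom (∃-nonRoot-binomial m 1# (- 1#) (-‿nonzero 1≉0) 3+m≤N)
    where
    3+m≤N : 3 ℕ.+ m ℕ.≤ N
    3+m≤N = ℕ.≤-trans (s≤s (ℕ.≤-trans 2+m≤[1+m]*2 (ℕ.*-monoʳ-≤ (suc m) 2≤d)))
                      (ℕ.≤-reflexive (≡.trans (≡.cong suc (≡.sym N-1≡[1+m]d)) 1+[N-1]≡N))
      where
      double : ∀ m → 2 ℕ.+ m ℕ.+ m ≡ suc m ℕ.* 2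
      double = solve-∀
      2+m≤[1+m]*2 : 2 ℕ.+ m ℕ.≤ suc m ℕ.* 2
      2+m≤[1+m]*2 = ℕ.≤-trans (ℕ.m≤m+n (2 ℕ.+ m) m) (ℕ.≤-reflexive (double m))
    rootFrom : (∃ λ y → y * (- 1# + 1# * y ^ᶠ suc m) ≉ 0#) → ∃ λ ζ → ζ ^ᶠ d ≈ 1# × ζ ≉ 1#
    rootFrom (y , nonRoot) = y ^ᶠ suc m , ζ^d≈1 , ζ≉1
      where
      y≉0 : y ≉ 0#
      y≉0 y≈0 = nonRoot (trans (*-congʳ y≈0) (zeroˡ _))
      ζ^d≈1 : (y ^ᶠ suc m) ^ᶠ d ≈ 1#
      ζ^d≈1 = trans (^-assocʳ y (suc m) d) (trans (reflexive (≡.cong (y ^ᶠ_) (≡.sym N-1≡[1+m]d))) (x^[N-1]≈1 y≉0))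
      ζ≉1 : y ^ᶠ suc m ≉ 1#
      ζ≉1 ζ≈1 = nonRoot (trans (*-congˡ (trans (+-congˡ (trans (*-identityˡ _) ζ≈1)) (-‿inverseˡ 1#))) (zeroʳ y))

  ^-injective-Bézout : ∀ {a b} m s x y → a ≉ 0# → 1 ℕ.+ y ℕ.* s ≡ x ℕ.* m
                     → a ^ᶠ m ≈ b ^ᶠ m → a ^ᶠ s ≈ b ^ᶠ s → a ≈ b
  ^-injective-Bézout {a} {b} m s x y a≉0 eq a^m≈b^m a^s≈b^s = *-cancelʳ (^-nonzero y (^-nonzero s a≉0)) (begin
    a * (a ^ᶠ s) ^ᶠ y     ≈⟨ *-congˡ (sym (^-*-comm a y s)) ⟩
    a ^ᶠ (1 ℕ.+ y ℕ.* s)  ≡⟨ ≡.cong (a ^ᶠ_) eq ⟩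
    a ^ᶠ (x ℕ.* m)        ≈⟨ ^-*-comm a x m ⟩
    (a ^ᶠ m) ^ᶠ x         ≈⟨ ^-congˡ x a^m≈b^m ⟩
    (b ^ᶠ m) ^ᶠ x         ≈⟨ sym (^-*-comm b x m) ⟩
    b ^ᶠ (x ℕ.* m)        ≡⟨ ≡.cong (b ^ᶠ_) eq ⟨
    b * b ^ᶠ (y ℕ.* s)    ≈⟨ *-congˡ (^-*-comm b y s) ⟩
    b * (b ^ᶠ s) ^ᶠ y     ≈⟨ *-congˡ (^-congˡ y (sym a^s≈b^s)) ⟩
    b * (a ^ᶠ s) ^ᶠ y     ∎)

  ^-injective-coprime : ∀ {a b} m s → a ≉ 0# → a ^ᶠ m ≈ b ^ᶠ m → a ^ᶠ s ≈ b ^ᶠ s → gcd m s ≡ 1 → a ≈ b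
  ^-injective-coprime {a} {b} m s a≉0 a^m≈b^m a^s≈b^s gcd≡1 with Bézout.identity (gcd-GCD m s)
  ... | Bézout.+- x y eq = ^-injective-Bézout m s x y a≉0 (≡.subst (λ g → g ℕ.+ y ℕ.* s ≡ x ℕ.* m) gcd≡1 eq) a^m≈b^m a^s≈b^s
  ... | Bézout.-+ x y eq = ^-injective-Bézout s m y x a≉0 (≡.subst (λ g → g ℕ.+ x ℕ.* m ≡ y ℕ.* s) gcd≡1 eq) a^s≈b^s a^m≈b^m

  ∃-root-coprime : ∀ {ω} m s → ω ≉ 0# → ω ^ᶠ s ≈ 1# → gcd m s ≡ 1 → ∃ λ t → t ^ᶠ s ≈ 1# × t ^ᶠ m ≈ ω
  ∃-root-coprime {ω} m s ω≉0 ω^s≈1 gcd≡1 with Bézout.identity (gcd-GCD m s)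
  ... | Bézout.+- x y eq = ω ^ᶠ x , x^s≈1⇒[x^j]^s≈1 x s ω^s≈1 , (begin
    (ω ^ᶠ x) ^ᶠ m         ≈⟨ ^-assocʳ ω x m ⟩
    ω ^ᶠ (x ℕ.* m)        ≡⟨ ≡.cong (ω ^ᶠ_) (≡.subst (λ g → g ℕ.+ y ℕ.* s ≡ x ℕ.* m) gcd≡1 eq) ⟨
    ω * ω ^ᶠ (y ℕ.* s)    ≈⟨ *-congˡ (x^d≈1⇒x^md≈1 s (y ℕ.* s) ω^s≈1 (divides y ≡.refl)) ⟩
    ω * 1#                ≈⟨ *-identityʳ ω ⟩
    ω                     ∎)
  ... | Bézout.-+ x y eq = t , t^s≈1 , t^m≈ω
    where
    a = ω ^ᶠ x
    a≉0 = ^-nonzero x ω≉0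
    t = a ⁻¹⟨ a≉0 ⟩
    t*a≈1 : t * a ≈ 1#
    t*a≈1 = trans (*-comm t a) (x*x⁻¹≈1 a a≉0)
    t^j*a^j≈1 : ∀ j → t ^ᶠ j * a ^ᶠ j ≈ 1#
    t^j*a^j≈1 j = trans (sym (^-distrib-* t a j)) (trans (^-congˡ j t*a≈1) (1^m≈1 j))
    t^s≈1 : t ^ᶠ s ≈ 1#
    t^s≈1 = begin
      t ^ᶠ s               ≈⟨ sym (*-identityʳ _) ⟩
      t ^ᶠ s * 1#          ≈⟨ *-congˡ (sym (x^s≈1⇒[x^j]^s≈1 x s ω^s≈1)) ⟩
      t ^ᶠ s * a ^ᶠ s      ≈⟨ t^j*a^j≈1 s ⟩
      1#                   ∎
    a^m*ω≈1 : a ^ᶠ m * ω ≈ 1#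
    a^m*ω≈1 = begin
      a ^ᶠ m * ω           ≈⟨ *-comm _ ω ⟩
      ω * (ω ^ᶠ x) ^ᶠ m    ≈⟨ *-congˡ (^-assocʳ ω x m) ⟩
      ω ^ᶠ (1 ℕ.+ x ℕ.* m) ≡⟨ ≡.cong (ω ^ᶠ_) (≡.subst (λ g → g ℕ.+ x ℕ.* m ≡ y ℕ.* s) gcd≡1 eq) ⟩
      ω ^ᶠ (y ℕ.* s)       ≈⟨ ^-*-comm ω y s ⟩
      (ω ^ᶠ s) ^ᶠ y        ≈⟨ trans (^-congˡ y ω^s≈1) (1^m≈1 y) ⟩
      1#                   ∎
    t^m≈ω : t ^ᶠ m ≈ ω
    t^m≈ω = *-cancelˡ (^-nonzero m a≉0) (trans (*-comm _ _) (trans (t^j*a^j≈1 m) (sym a^m*ω≈1)))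

  module Frobenius {p} (p-prime : Prime p) (p≈0 : p ×ₙ 1# ≈ 0#) where
    open import Algebra.Properties.CommutativeSemiring.Binomial commutativeSemiring as Binomial using ()

    multiple×≈0 : ∀ m x → p ∣ m → m ×ₙ x ≈ 0#
    multiple×≈0 m x (divides d ≡.refl) = begin
      (d ℕ.* p) ×ₙ x               ≈⟨ sym (trans (×-assoc-* (d ℕ.* p) 1# x) (×-congʳ (d ℕ.* p) (*-identityˡ x))) ⟩
      ((d ℕ.* p) ×ₙ 1#) * x        ≈⟨ *-congʳ (×1-homo-* d p) ⟩
      ((d ×ₙ 1#) * (p ×ₙ 1#)) * x  ≈⟨ *-congʳ (trans (*-congˡ p≈0) (zeroʳ _)) ⟩
      0# * x                       ≈⟨ zeroˡ x ⟩
      0#                           ∎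

    -- p divides every middle coefficient p C i of the binomial expansion.
    ^p-+ : ∀ x y → (x + y) ^ᶠ p ≈ x ^ᶠ p + y ^ᶠ p
    ^p-+ x y = expand p ≡.refl (ℕ.nonTrivial⇒n>1 p {{prime⇒nonTrivial p-prime}})
      where
      expand : ∀ p′ → p′ ≡ p → 1 ℕ.< p′ → (x + y) ^ᶠ p′ ≈ x ^ᶠ p′ + y ^ᶠ p′
      expand (suc (suc n)) ≡.refl _ = begin
        (x + y) ^ᶠ p                                   ≈⟨ Binomial.theorem p x y ⟩
        t zero + Σ+.sum (λ i → t (suc i))              ≈⟨ +-congˡ (Σ+.sum-init-last (λ i → t (suc i))) ⟩
        t zero + (Σ+.sum (λ i → t (suc (Fin.inject₁ i))) + t (suc (Fin.fromℕ (suc n))))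
                                                       ≈⟨ +-cong first (+-cong middle last) ⟩
        y ^ᶠ p + (0# + x ^ᶠ p)                         ≈⟨ +-cong refl (+-identityˡ _) ⟩
        y ^ᶠ p + x ^ᶠ p                                ≈⟨ +-comm _ _ ⟩
        x ^ᶠ p + y ^ᶠ p                                ∎
        where
        t = Binomial.binomialTerm x y p
        term : ∀ i k → toℕ i ≡ k → t i ≈ (p C k) ×ₙ (x ^ᶠ k * y ^ᶠ (p ∸ k))
        term i k ≡.refl = refl
        first : t zero ≈ y ^ᶠ p
        first = trans (×-homo-1 _) (*-identityˡ _)
        last : t (suc (Fin.fromℕ (suc n))) ≈ x ^ᶠ p
        last = begin
          t (suc (Fin.fromℕ (suc n)))          ≈⟨ term _ p (≡.cong suc (Fin.toℕ-fromℕ (suc n))) ⟩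
          (p C p) ×ₙ (x ^ᶠ p * y ^ᶠ (p ∸ p))   ≡⟨ ≡.cong₂ _×ₙ_ (nCn≡1 p) (≡.cong (λ e → x ^ᶠ p * y ^ᶠ e) (ℕ.n∸n≡0 p)) ⟩
          1 ×ₙ (x ^ᶠ p * 1#)                   ≈⟨ ×-homo-1 _ ⟩
          x ^ᶠ p * 1#                          ≈⟨ *-identityʳ _ ⟩
          x ^ᶠ p                               ∎
        middle : Σ+.sum (λ i → t (suc (Fin.inject₁ i))) ≈ 0#
        middle = trans (Σ+.sum-cong-≋ vanishes) (Σ+.sum-replicate-zero (suc n))
          where
          vanishes : ∀ i → t (suc (Fin.inject₁ i)) ≈ 0#
          vanishes i = trans (term _ (suc (toℕ i)) (≡.cong suc (Fin.toℕ-inject₁ i)))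
            (multiple×≈0 _ _ (prime∣C p-prime (suc (toℕ i)) (s≤s z≤n) (s≤s (Fin.toℕ<n i))))

    ^p^e-+ : ∀ e x y → (x + y) ^ᶠ (p ^ e) ≈ x ^ᶠ (p ^ e) + y ^ᶠ (p ^ e)
    ^p^e-+ zero    x y = trans (*-identityʳ _) (sym (+-cong (*-identityʳ x) (*-identityʳ y)))
    ^p^e-+ (suc e) x y = begin
      (x + y) ^ᶠ (p ℕ.* p ^ e)                    ≈⟨ sym (^-assocʳ (x + y) p (p ^ e)) ⟩
      ((x + y) ^ᶠ p) ^ᶠ (p ^ e)                   ≈⟨ ^-congˡ (p ^ e) (^p-+ x y) ⟩
      (x ^ᶠ p + y ^ᶠ p) ^ᶠ (p ^ e)                ≈⟨ ^p^e-+ e _ _ ⟩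
      (x ^ᶠ p) ^ᶠ (p ^ e) + (y ^ᶠ p) ^ᶠ (p ^ e)   ≈⟨ +-cong (^-assocʳ x p _) (^-assocʳ y p _) ⟩
      x ^ᶠ (p ℕ.* p ^ e) + y ^ᶠ (p ℕ.* p ^ e)     ∎

-- Q = q′ + 2, so that q = Q - 1 ≥ 1.
module Conjugation {c ℓ} (q′ : ℕ) (F : FiniteField c ℓ (suc (suc q′) ^ 2))
                   {p e} (p-prime : Prime p) (Q≡p^e : suc (suc q′) ≡ p ^ e) where
  open FiniteFieldProperties F public

  q Q N : ℕ
  q = suc q′
  Q = suc q
  N = Q ^ 2

  open Frobenius p-prime (characteristic p (e ℕ.* 2) (≡.trans (≡.cong (_^ 2) Q≡p^e) (ℕ.^-*-assoc p e 2)))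

  -- σ is the Frobenius automorphism of F over its subfield with Q elements,
  -- and σ u * u is the norm of u to that subfield.
  σ : Carrier → Carrier
  σ x = x ^ᶠ Q

  σ-cong : ∀ {x y} → x ≈ y → σ x ≈ σ y
  σ-cong = ^-congˡ Q

  σ-+ : ∀ x y → σ (x + y) ≈ σ x + σ y
  σ-+ x y = begin
    (x + y) ^ᶠ Q                    ≡⟨ ≡.cong ((x + y) ^ᶠ_) Q≡p^e ⟩
    (x + y) ^ᶠ (p ^ e)              ≈⟨ ^p^e-+ e x y ⟩
    x ^ᶠ (p ^ e) + y ^ᶠ (p ^ e)     ≡⟨ ≡.cong₂ (λ a b → x ^ᶠ a + y ^ᶠ b) Q≡p^e Q≡p^e ⟨
    x ^ᶠ Q + y ^ᶠ Q                 ∎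

  σ-* : ∀ x y → σ (x * y) ≈ σ x * σ y
  σ-* x y = ^-distrib-* x y Q

  σ-0 : σ 0# ≈ 0#
  σ-0 = zeroˡ _

  σ-1 : σ 1# ≈ 1#
  σ-1 = 1^m≈1 Q

  σ-neg : ∀ x → σ (- x) ≈ - σ x
  σ-neg x = +-inverseʳ-unique (σ x) (σ (- x)) (trans (sym (σ-+ x (- x))) (trans (σ-cong (-‿inverseʳ x)) σ-0))

  σ-^ : ∀ x m → σ (x ^ᶠ m) ≈ σ x ^ᶠ m
  σ-^ x m = ^-comm x m Q

  σ-involutive : ∀ x → σ (σ x) ≈ x
  σ-involutive x = begin
    (x ^ᶠ Q) ^ᶠ Q   ≈⟨ ^-assocʳ x Q Q ⟩
    x ^ᶠ (Q ℕ.* Q)  ≡⟨ ≡.cong (λ m → x ^ᶠ (Q ℕ.* m)) (ℕ.*-identityʳ Q) ⟨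
    x ^ᶠ N          ≈⟨ fermat x ⟩
    x               ∎

  x^[Q+1]≈σx*x : ∀ x → x ^ᶠ (Q ℕ.+ 1) ≈ σ x * x
  x^[Q+1]≈σx*x x = trans (^-homo-* x Q 1) (*-congˡ (*-identityʳ x))

  NormOne : Carrier → Set ℓ
  NormOne u = σ u * u ≈ 1#

  NormOne⇒≉0 : ∀ {u} → NormOne u → u ≉ 0#
  NormOne⇒≉0 {u} Nu u≈0 = 1≉0 (trans (sym Nu) (trans (*-congˡ u≈0) (zeroʳ _)))

  NormOne⇒^[k*[Q+1]]≈1 : ∀ {u} k → NormOne u → u ^ᶠ (k ℕ.* (Q ℕ.+ 1)) ≈ 1#
  NormOne⇒^[k*[Q+1]]≈1 {u} k Nu =
    x^d≈1⇒x^md≈1 (Q ℕ.+ 1) (k ℕ.* (Q ℕ.+ 1)) (trans (x^[Q+1]≈σx*x u) Nu) (divides k ≡.refl)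

  N-1≡[Q+1]*q : N ∸ 1 ≡ (Q ℕ.+ 1) ℕ.* q
  N-1≡[Q+1]*q = ℕ.suc-injective (≡.trans 1+[N-1]≡N (factor q′))
    where
    factor : ∀ a → suc (suc a) ℕ.* (suc (suc a) ℕ.* 1) ≡ suc ((suc (suc a) ℕ.+ 1) ℕ.* suc a)
    factor = solve-∀

  q∣N-1 : q ∣ N ∸ 1
  q∣N-1 = divides (Q ℕ.+ 1) N-1≡[Q+1]*q

  Q+1∣N-1 : Q ℕ.+ 1 ∣ N ∸ 1
  Q+1∣N-1 = divides q (≡.trans N-1≡[Q+1]*q (ℕ.*-comm (Q ℕ.+ 1) q))

  NormOne-^q : ∀ {x} → x ≉ 0# → NormOne (x ^ᶠ q)
  NormOne-^q {x} x≉0 = trans (sym (x^[Q+1]≈σx*x (x ^ᶠ q))) (begin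
    (x ^ᶠ q) ^ᶠ (Q ℕ.+ 1)  ≈⟨ ^-assocʳ x q (Q ℕ.+ 1) ⟩
    x ^ᶠ (q ℕ.* (Q ℕ.+ 1)) ≡⟨ ≡.cong (x ^ᶠ_) (≡.trans (ℕ.*-comm q (Q ℕ.+ 1)) (≡.sym N-1≡[Q+1]*q)) ⟩
    x ^ᶠ (N ∸ 1)           ≈⟨ x^[N-1]≈1 x≉0 ⟩
    1#                     ∎)

  -- Hilbert 90: for c with c + σ u * σ c ≉ 0, x = c + σ u * σ c satisfies σ x ≈ u * x,
  -- i.e. x ^ q ≈ u.  Such c exists because c + σ u * c ^ Q has degree Q < N.
  hilbert90 : ∀ {u} → NormOne u → ∃ λ x → x ≉ 0# × x ^ᶠ q ≈ u
  hilbert90 {u} Nu = rootFrom (∃-nonRoot-binomial q′ (σ u) 1# 1≉0 Q+1≤N)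
    where
    Q+1≤N : 3 ℕ.+ q′ ℕ.≤ N
    Q+1≤N = ℕ.≤-trans (ℕ.m≤m+n (3 ℕ.+ q′) (suc q′ ℕ.+ q′ ℕ.* suc (suc q′))) (ℕ.≤-reflexive (expand q′))
      where
      expand : ∀ a → 3 ℕ.+ a ℕ.+ (suc a ℕ.+ a ℕ.* suc (suc a)) ≡ suc (suc a) ℕ.* (suc (suc a) ℕ.* 1)
      expand = solve-∀
    rootFrom : (∃ λ c → c * (1# + σ u * c ^ᶠ q) ≉ 0#) → ∃ λ x → x ≉ 0# × x ^ᶠ q ≈ u
    rootFrom (c , nonRoot) = x , x≉0 , x^q≈u
      where
      x = c + σ u * σ c
      x≉0 : x ≉ 0#
      x≉0 x≈0 = nonRoot (trans (expand c (σ u) (c ^ᶠ q)) x≈0)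
        where
        expand : ∀ c s y → c * (1# + s * y) ≈ c + s * (c * y)
        expand = solve 3 (λ c s y → c :* (con (+ 1) :+ s :* y) := c :+ s :* (c :* y)) refl
      σx≈u*x : σ x ≈ u * x
      σx≈u*x = begin
        σ (c + σ u * σ c)          ≈⟨ σ-+ _ _ ⟩
        σ c + σ (σ u * σ c)        ≈⟨ +-congˡ (trans (σ-* _ _) (*-cong (σ-involutive u) (σ-involutive c))) ⟩
        σ c + u * c                ≈⟨ +-comm _ _ ⟩
        u * c + σ c                ≈⟨ +-congˡ (sym (trans (*-congʳ Nu) (*-identityˡ _))) ⟩
        u * c + (σ u * u) * σ c    ≈⟨ factor u (σ u) c (σ c) ⟩
        u * x                      ∎
        where
        factor : ∀ u su c sc → u * c + (su * u) * sc ≈ u * (c + su * sc)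
        factor = solve 4 (λ u su c sc → u :* c :+ (su :* u) :* sc := u :* (c :+ su :* sc)) refl
      x^q≈u : x ^ᶠ q ≈ u
      x^q≈u = *-cancelˡ x≉0 (trans σx≈u*x (*-comm u x))

  σ-ratio⇒^q≈ : ∀ {κ μ y₁ y₂} → κ ≉ 0# → y₁ ≉ 0# → y₂ ≉ 0#
               → κ * σ y₁ ≈ μ * y₁ → κ * σ y₂ ≈ μ * y₂ → y₁ ^ᶠ q ≈ y₂ ^ᶠ q
  σ-ratio⇒^q≈ {κ} {μ} {y₁} {y₂} κ≉0 y₁≉0 y₂≉0 rel₁ rel₂ =
    *-cancelˡ (*-nonzero (*-nonzero κ≉0 y₁≉0) y₂≉0) (begin
      (κ * y₁ * y₂) * y₁ ^ᶠ q   ≈⟨ regroup κ y₁ y₂ (y₁ ^ᶠ q) ⟩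
      (κ * σ y₁) * y₂           ≈⟨ *-congʳ rel₁ ⟩
      (μ * y₁) * y₂             ≈⟨ swap μ y₁ y₂ ⟩
      (μ * y₂) * y₁             ≈⟨ *-congʳ rel₂ ⟨
      (κ * σ y₂) * y₁           ≈⟨ regroup κ y₂ y₁ (y₂ ^ᶠ q) ⟨
      (κ * y₂ * y₁) * y₂ ^ᶠ q   ≈⟨ *-congʳ (swap κ y₂ y₁) ⟩
      (κ * y₁ * y₂) * y₂ ^ᶠ q   ∎)
    where
    regroup : ∀ l a b c → (l * a * b) * c ≈ (l * (a * c)) * b
    regroup = solve 4 (λ l a b c → (l :* a :* b) :* c := (l :* (a :* c)) :* b) refl
    swap : ∀ l a b → (l * a) * b ≈ (l * b) * a
    swap = solve 3 (λ l a b → (l :* a) :* b := (l :* b) :* a) refl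

  module Polynomial (n k : ℕ) (β γ : Carrier) (Nβ : NormOne β) (¬Nγ : ¬ NormOne γ) where

    r m : ℕ
    r = n ℕ.+ k ℕ.* (Q ℕ.+ 1)
    m = n ℕ.+ 2 ℕ.* k

    A B h G : Carrier → Carrier
    A u = γ * u + - β
    B u = u + - (σ γ * β)
    h u = A u ^ᶠ n + - (γ * B u ^ᶠ n)
    G u = (- B u) ^ᶠ n + - (σ γ * (- A u) ^ᶠ n)

    f : Carrier → Carrier
    f x = x ^ᶠ r * h (x ^ᶠ q)

    A-cong : ∀ {u v} → u ≈ v → A u ≈ A v
    A-cong u≈v = +-congʳ (*-congˡ u≈v)

    B-cong : ∀ {u v} → u ≈ v → B u ≈ B v
    B-cong u≈v = +-congʳ u≈v

    h-cong : ∀ {u v} → u ≈ v → h u ≈ h v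
    h-cong u≈v = +-cong (^-congˡ n (A-cong u≈v)) (-‿cong (*-congˡ (^-congˡ n (B-cong u≈v))))

    f-cong : ∀ {x y} → x ≈ y → f x ≈ f y
    f-cong x≈y = *-cong (^-congˡ r x≈y) (h-cong (^-congˡ q x≈y))

    β≉0 : β ≉ 0#
    β≉0 = NormOne⇒≉0 Nβ

    1-σγγ≉0 : 1# + - (σ γ * γ) ≉ 0#
    1-σγγ≉0 eq = ¬Nγ (sym (x-y≈0⇒x≈y 1# _ eq))

    *[1-σγγ]≈0⇒≈0 : ∀ {D} → D * (1# + - (σ γ * γ)) ≈ 0# → D ≈ 0#
    *[1-σγγ]≈0⇒≈0 eq = x*y≈0⇒y≈0 1-σγγ≉0 (trans (*-comm _ _) eq)

    x^r≈x^m*[x^q]^k : ∀ x → x ^ᶠ r ≈ x ^ᶠ m * (x ^ᶠ q) ^ᶠ k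
    x^r≈x^m*[x^q]^k x = begin
      x ^ᶠ r                       ≡⟨ ≡.cong (x ^ᶠ_) (split n k q′) ⟩
      x ^ᶠ (m ℕ.+ k ℕ.* q)         ≈⟨ ^-homo-* x m (k ℕ.* q) ⟩
      x ^ᶠ m * x ^ᶠ (k ℕ.* q)      ≈⟨ *-congˡ (^-*-comm x k q) ⟩
      x ^ᶠ m * (x ^ᶠ q) ^ᶠ k       ∎
      where
      split : ∀ n k a → n ℕ.+ k ℕ.* (suc (suc a) ℕ.+ 1) ≡ n ℕ.+ 2 ℕ.* k ℕ.+ k ℕ.* suc a
      split = solve-∀

    f-scale : ∀ {t} x → t ^ᶠ q ≈ 1# → f (t * x) ≈ t ^ᶠ m * f x
    f-scale {t} x t^q≈1 = begin
      (t * x) ^ᶠ r * h ((t * x) ^ᶠ q)   ≈⟨ *-cong (^-distrib-* t x r) (h-cong (x^s≈1⇒[x*y]^s≈y^s x q t^q≈1)) ⟩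
      (t ^ᶠ r * x ^ᶠ r) * h (x ^ᶠ q)    ≈⟨ *-assoc _ _ _ ⟩
      t ^ᶠ r * f x                      ≈⟨ *-congʳ t^r≈t^m ⟩
      t ^ᶠ m * f x                      ∎
      where
      t^r≈t^m : t ^ᶠ r ≈ t ^ᶠ m
      t^r≈t^m = trans (x^r≈x^m*[x^q]^k t) (trans (*-congˡ (trans (^-congˡ k t^q≈1) (1^m≈1 k))) (*-identityʳ _))

    G≈±[B^n-σγA^n] : ∀ u → G u ≈ (- 1#) ^ᶠ n * (B u ^ᶠ n + - (σ γ * A u ^ᶠ n))
    G≈±[B^n-σγA^n] u = begin
      (- B u) ^ᶠ n + - (σ γ * (- A u) ^ᶠ n)            ≈⟨ +-cong (-x^n (B u)) (-‿cong (*-congˡ (-x^n (A u)))) ⟩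
      s * B u ^ᶠ n + - (σ γ * (s * A u ^ᶠ n))          ≈⟨ factor s (B u ^ᶠ n) (A u ^ᶠ n) (σ γ) ⟩
      s * (B u ^ᶠ n + - (σ γ * A u ^ᶠ n))              ∎
      where
      s = (- 1#) ^ᶠ n
      -x^n : ∀ x → (- x) ^ᶠ n ≈ s * x ^ᶠ n
      -x^n x = trans (^-congˡ n (sym (-1*x≈-x x))) (^-distrib-* (- 1#) x n)
      factor : ∀ s b a g → s * b + - (g * (s * a)) ≈ s * (b + - (g * a))
      factor = solve 4 (λ s b a g → s :* b :- g :* (s :* a) := s :* (b :- g :* a)) refl

    σ-A : ∀ u → σ (A u) ≈ σ γ * σ u + - σ β
    σ-A u = trans (σ-+ _ _) (+-cong (σ-* γ u) (σ-neg β))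

    σ-B : ∀ u → σ (B u) ≈ σ u + - (γ * σ β)
    σ-B u = trans (σ-+ _ _) (+-congˡ (trans (σ-neg _) (-‿cong (trans (σ-* _ _) (*-congʳ (σ-involutive γ))))))

    module _ {u} (Nu : NormOne u) where

      uβσA≈-B : (u * β) * σ (A u) ≈ - B u
      uβσA≈-B = begin
        (u * β) * σ (A u)                          ≈⟨ *-congˡ (σ-A u) ⟩
        (u * β) * (σ γ * σ u + - σ β)              ≈⟨ expand u β (σ γ) (σ u) (σ β) ⟩
        σ γ * β * (σ u * u) + - (u * (σ β * β))    ≈⟨ +-cong (trans (*-congˡ Nu) (*-identityʳ _)) (-‿cong (trans (*-congˡ Nβ) (*-identityʳ _))) ⟩
        σ γ * β + - u                              ≈⟨ negate u β (σ γ) ⟩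
        - B u                                      ∎
        where
        expand : ∀ u b g su sb → (u * b) * (g * su + - sb) ≈ g * b * (su * u) + - (u * (sb * b))
        expand = solve 5 (λ u b g su sb → (u :* b) :* (g :* su :- sb) := g :* b :* (su :* u) :- u :* (sb :* b)) refl
        negate : ∀ u b g → g * b + - u ≈ - (u + - (g * b))
        negate = solve 3 (λ u b g → g :* b :- u := :- (u :- g :* b)) refl

      uβσB≈-A : (u * β) * σ (B u) ≈ - A u
      uβσB≈-A = begin
        (u * β) * σ (B u)                          ≈⟨ *-congˡ (σ-B u) ⟩
        (u * β) * (σ u + - (γ * σ β))              ≈⟨ expand u β γ (σ u) (σ β) ⟩
        β * (σ u * u) + - (γ * u * (σ β * β))      ≈⟨ +-cong (trans (*-congˡ Nu) (*-identityʳ _)) (-‿cong (trans (*-congˡ Nβ) (*-identityʳ _))) ⟩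
        β + - (γ * u)                              ≈⟨ negate u β γ ⟩
        - A u                                      ∎
        where
        expand : ∀ u b g su sb → (u * b) * (su + - (g * sb)) ≈ b * (su * u) + - (g * u * (sb * b))
        expand = solve 5 (λ u b g su sb → (u :* b) :* (su :- g :* sb) := b :* (su :* u) :- g :* u :* (sb :* b)) refl
        negate : ∀ u b g → b + - (g * u) ≈ - (g * u + - b)
        negate = solve 3 (λ u b g → b :- g :* u := :- (g :* u :- b)) refl

      [uβ]^n*σh≈G : (u * β) ^ᶠ n * σ (h u) ≈ G u
      [uβ]^n*σh≈G = begin
        w ^ᶠ n * σ (A u ^ᶠ n + - (γ * B u ^ᶠ n))
          ≈⟨ *-congˡ (trans (σ-+ _ _) (+-cong (σ-^ _ n) (trans (σ-neg _) (-‿cong (trans (σ-* _ _) (*-congˡ (σ-^ _ n))))))) ⟩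
        w ^ᶠ n * (σ (A u) ^ᶠ n + - (σ γ * σ (B u) ^ᶠ n))
          ≈⟨ distribute (w ^ᶠ n) (σ (A u) ^ᶠ n) (σ (B u) ^ᶠ n) (σ γ) ⟩
        w ^ᶠ n * σ (A u) ^ᶠ n + - (σ γ * (w ^ᶠ n * σ (B u) ^ᶠ n))
          ≈⟨ +-cong (sym (^-distrib-* w _ n)) (-‿cong (*-congˡ (sym (^-distrib-* w _ n)))) ⟩
        (w * σ (A u)) ^ᶠ n + - (σ γ * (w * σ (B u)) ^ᶠ n)
          ≈⟨ +-cong (^-congˡ n uβσA≈-B) (-‿cong (*-congˡ (^-congˡ n uβσB≈-A))) ⟩
        G u ∎
        where
        w = u * β
        distribute : ∀ W X Y g → W * (X + - (g * Y)) ≈ W * X + - (g * (W * Y))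
        distribute = solve 4 (λ W X Y g → W :* (X :- g :* Y) := W :* X :- g :* (W :* Y)) refl

      B≉0 : B u ≉ 0#
      B≉0 B≈0 = ¬Nγ (begin
        σ γ * γ                    ≈⟨ sym (*-identityʳ _) ⟩
        σ γ * γ * 1#               ≈⟨ *-congˡ (sym Nβ) ⟩
        σ γ * γ * (σ β * β)        ≈⟨ regroup (σ γ) γ (σ β) β ⟩
        (γ * σ β) * (σ γ * β)      ≈⟨ *-cong (sym (trans (σ-* _ _) (*-congʳ (σ-involutive γ)))) (sym u≈σγβ) ⟩
        σ (σ γ * β) * u            ≈⟨ *-congʳ (σ-cong (sym u≈σγβ)) ⟩
        σ u * u                    ≈⟨ Nu ⟩
        1#                         ∎)
        where
        u≈σγβ : u ≈ σ γ * β
        u≈σγβ = x-y≈0⇒x≈y _ _ B≈0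
        regroup : ∀ sg g sb b → sg * g * (sb * b) ≈ (g * sb) * (sg * b)
        regroup = solve 4 (λ sg g sb b → sg :* g :* (sb :* b) := (g :* sb) :* (sg :* b)) refl

      A≉0 : A u ≉ 0#
      A≉0 A≈0 = B≉0 (begin
        B u                    ≈⟨ sym (-‿involutive _) ⟩
        - - B u                ≈⟨ -‿cong (sym uβσA≈-B) ⟩
        - ((u * β) * σ (A u))  ≈⟨ -‿cong (trans (*-congˡ (trans (σ-cong A≈0) σ-0)) (zeroʳ _)) ⟩
        - 0#                   ≈⟨ -0#≈0# ⟩
        0#                     ∎)

      -- If h u ≈ 0 then also G u ≈ 0, forcing B u ^ n * (1 - σ γ * γ) ≈ 0.
      h≉0 : h u ≉ 0#
      h≉0 h≈0 = ^-nonzero n B≉0 (*[1-σγγ]≈0⇒≈0 (begin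
        b * (1# + - (σ γ * γ))                     ≈⟨ combine b a γ (σ γ) ⟩
        (b + - (σ γ * a)) + σ γ * (a + - (γ * b))  ≈⟨ +-cong B^n-σγA^n≈0 (trans (*-congˡ h≈0) (zeroʳ _)) ⟩
        0# + 0#                                    ≈⟨ +-identityʳ 0# ⟩
        0#                                         ∎))
        where
        a = A u ^ᶠ n
        b = B u ^ᶠ n
        G≈0 : G u ≈ 0#
        G≈0 = trans (sym [uβ]^n*σh≈G) (trans (*-congˡ (trans (σ-cong h≈0) σ-0)) (zeroʳ _))
        B^n-σγA^n≈0 : b + - (σ γ * a) ≈ 0#
        B^n-σγA^n≈0 = x*y≈0⇒y≈0 (^-nonzero n (-‿nonzero 1≉0)) (trans (sym (G≈±[B^n-σγA^n] u)) G≈0)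
        combine : ∀ b a g sg → b * (1# + - (sg * g)) ≈ (b + - (sg * a)) + sg * (a + - (g * b))
        combine = solve 4 (λ b a g sg → b :* (con (+ 1) :- sg :* g) := (b :- sg :* a) :+ sg :* (a :- g :* b)) refl

      A*σA≈B*σB : A u * σ (A u) ≈ B u * σ (B u)
      A*σA≈B*σB = *-cancelˡ (*-nonzero (NormOne⇒≉0 Nu) β≉0) (begin
        w * (A u * σ (A u))    ≈⟨ x∙yz≈y∙xz w (A u) (σ (A u)) ⟩
        A u * (w * σ (A u))    ≈⟨ *-congˡ uβσA≈-B ⟩
        A u * - B u            ≈⟨ swap (A u) (B u) ⟩
        B u * - A u            ≈⟨ *-congˡ (sym uβσB≈-A) ⟩
        B u * (w * σ (B u))    ≈⟨ sym (x∙yz≈y∙xz w (B u) (σ (B u))) ⟩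
        w * (B u * σ (B u))    ∎)
        where
        w = u * β
        swap : ∀ a b → a * - b ≈ b * - a
        swap = solve 2 (λ a b → a :* (:- b) := b :* (:- a)) refl

    u^r≈u^n : ∀ {u} → NormOne u → u ^ᶠ r ≈ u ^ᶠ n
    u^r≈u^n {u} Nu = trans (^-homo-* u n _) (trans (*-congˡ (NormOne⇒^[k*[Q+1]]≈1 k Nu)) (*-identityʳ _))

    β^n*σf≈x^r*G : ∀ {x} → x ≉ 0# → β ^ᶠ n * σ (f x) ≈ x ^ᶠ r * G (x ^ᶠ q)
    β^n*σf≈x^r*G {x} x≉0 = begin
      β ^ᶠ n * σ (x ^ᶠ r * h u)                ≈⟨ *-congˡ (trans (σ-* _ _) (*-congʳ (σ-^ x r))) ⟩
      β ^ᶠ n * ((x * u) ^ᶠ r * σ (h u))        ≈⟨ *-congˡ (*-congʳ (trans (^-distrib-* x u r) (*-congˡ (u^r≈u^n Nu)))) ⟩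
      β ^ᶠ n * ((x ^ᶠ r * u ^ᶠ n) * σ (h u))   ≈⟨ regroup (β ^ᶠ n) (x ^ᶠ r) (u ^ᶠ n) (σ (h u)) ⟩
      x ^ᶠ r * ((u ^ᶠ n * β ^ᶠ n) * σ (h u))   ≈⟨ *-congˡ (*-congʳ (sym (^-distrib-* u β n))) ⟩
      x ^ᶠ r * ((u * β) ^ᶠ n * σ (h u))        ≈⟨ *-congˡ ([uβ]^n*σh≈G Nu) ⟩
      x ^ᶠ r * G u                             ∎
      where
      u = x ^ᶠ q
      Nu = NormOne-^q x≉0
      regroup : ∀ b X U H → b * ((X * U) * H) ≈ X * ((U * b) * H)
      regroup = solve 4 (λ b X U H → b :* ((X :* U) :* H) := X :* ((U :* b) :* H)) refl

    f≉0 : ∀ {x} → x ≉ 0# → f x ≉ 0#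
    f≉0 {x} x≉0 = *-nonzero (^-nonzero r x≉0) (h≉0 (NormOne-^q x≉0))

    f[0]≈0 : 0 ℕ.< n → f 0# ≈ 0#
    f[0]≈0 0<n = trans (*-congʳ (0^m≈0 (ℕ.<-≤-trans 0<n (ℕ.m≤m+n n _)))) (zeroˡ _)

    h*G-cross : ∀ {x₁ x₂} → x₁ ≉ 0# → x₂ ≉ 0# → f x₁ ≈ f x₂
              → h (x₁ ^ᶠ q) * G (x₂ ^ᶠ q) ≈ h (x₂ ^ᶠ q) * G (x₁ ^ᶠ q)
    h*G-cross {x₁} {x₂} x₁≉0 x₂≉0 fx₁≈fx₂ = *-cancelˡ (*-nonzero (^-nonzero r x₁≉0) (^-nonzero r x₂≉0)) (begin
      (R₁ * R₂) * (h₁ * G₂)   ≈⟨ interchange R₁ R₂ h₁ G₂ ⟩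
      (R₁ * h₁) * (R₂ * G₂)   ≈⟨ *-cong fx₁≈fx₂ (sym R₁G₁≈R₂G₂) ⟩
      (R₂ * h₂) * (R₁ * G₁)   ≈⟨ trans (interchange R₁ R₂ G₁ h₂) (*-comm _ _) ⟨
      (R₁ * R₂) * (G₁ * h₂)   ≈⟨ *-congˡ (*-comm G₁ h₂) ⟩
      (R₁ * R₂) * (h₂ * G₁)   ∎)
      where
      R₁ = x₁ ^ᶠ r
      R₂ = x₂ ^ᶠ r
      h₁ = h (x₁ ^ᶠ q)
      h₂ = h (x₂ ^ᶠ q)
      G₁ = G (x₁ ^ᶠ q)
      G₂ = G (x₂ ^ᶠ q)
      R₁G₁≈R₂G₂ : R₁ * G₁ ≈ R₂ * G₂
      R₁G₁≈R₂G₂ = trans (sym (β^n*σf≈x^r*G x₁≉0)) (trans (*-congˡ (σ-cong fx₁≈fx₂)) (β^n*σf≈x^r*G x₂≉0))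
      interchange : ∀ a b c d → (a * b) * (c * d) ≈ (a * c) * (b * d)
      interchange = solve 4 (λ a b c d → (a :* b) :* (c :* d) := (a :* c) :* (b :* d)) refl

    -- After cancelling the sign (- 1) ^ n in G, the cross relation reads (a₁ b₂ - a₂ b₁)(1 - σ γ γ) ≈ 0.
    A^n*B^n-cross : ∀ u₁ u₂ → h u₁ * G u₂ ≈ h u₂ * G u₁ → A u₁ ^ᶠ n * B u₂ ^ᶠ n ≈ A u₂ ^ᶠ n * B u₁ ^ᶠ n
    A^n*B^n-cross u₁ u₂ cross = x-y≈0⇒x≈y _ _ (*[1-σγγ]≈0⇒≈0 (begin
      (a₁ * b₂ + - (a₂ * b₁)) * (1# + - (σ γ * γ))
        ≈⟨ expand a₁ a₂ b₁ b₂ γ (σ γ) ⟩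
      h u₁ * (b₂ + - (σ γ * a₂)) + - (h u₂ * (b₁ + - (σ γ * a₁)))
        ≈⟨ +-congˡ (-‿cong (sym h₁C₂≈h₂C₁)) ⟩
      h u₁ * (b₂ + - (σ γ * a₂)) + - (h u₁ * (b₂ + - (σ γ * a₂)))
        ≈⟨ -‿inverseʳ _ ⟩
      0# ∎))
      where
      a₁ = A u₁ ^ᶠ n
      a₂ = A u₂ ^ᶠ n
      b₁ = B u₁ ^ᶠ n
      b₂ = B u₂ ^ᶠ n
      s = (- 1#) ^ᶠ n
      h₁C₂≈h₂C₁ : h u₁ * (b₂ + - (σ γ * a₂)) ≈ h u₂ * (b₁ + - (σ γ * a₁))
      h₁C₂≈h₂C₁ = *-cancelˡ (^-nonzero n (-‿nonzero 1≉0)) (begin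
        s * (h u₁ * (b₂ + - (σ γ * a₂)))  ≈⟨ x∙yz≈y∙xz s (h u₁) _ ⟩
        h u₁ * (s * (b₂ + - (σ γ * a₂)))  ≈⟨ *-congˡ (sym (G≈±[B^n-σγA^n] u₂)) ⟩
        h u₁ * G u₂                       ≈⟨ cross ⟩
        h u₂ * G u₁                       ≈⟨ *-congˡ (G≈±[B^n-σγA^n] u₁) ⟩
        h u₂ * (s * (b₁ + - (σ γ * a₁)))  ≈⟨ x∙yz≈y∙xz s (h u₂) _ ⟨
        s * (h u₂ * (b₁ + - (σ γ * a₁)))  ∎)
      expand : ∀ a₁ a₂ b₁ b₂ g sg → (a₁ * b₂ + - (a₂ * b₁)) * (1# + - (sg * g))
             ≈ (a₁ + - (g * b₁)) * (b₂ + - (sg * a₂)) + - ((a₂ + - (g * b₂)) * (b₁ + - (sg * a₁)))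
      expand = solve 6 (λ a₁ a₂ b₁ b₂ g sg → (a₁ :* b₂ :- a₂ :* b₁) :* (con (+ 1) :- sg :* g)
             := (a₁ :- g :* b₁) :* (b₂ :- sg :* a₂) :- (a₂ :- g :* b₂) :* (b₁ :- sg :* a₁)) refl

    -- A σ A ≈ B σ B makes the norms of A u₁ * B u₂ and A u₂ * B u₁ equal, so
    -- gcd (n, Q + 1) ≡ 1 lets the n-th powers determine them.
    A*B-cross : ∀ {u₁ u₂} → NormOne u₁ → NormOne u₂ → gcd n (Q ℕ.+ 1) ≡ 1
              → A u₁ ^ᶠ n * B u₂ ^ᶠ n ≈ A u₂ ^ᶠ n * B u₁ ^ᶠ n → A u₁ * B u₂ ≈ A u₂ * B u₁
    A*B-cross {u₁} {u₂} Nu₁ Nu₂ gcd≡1 cross = ^-injective-coprime n (Q ℕ.+ 1)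
      (*-nonzero (A≉0 Nu₁) (B≉0 Nu₂))
      (trans (^-distrib-* _ _ n) (trans cross (sym (^-distrib-* _ _ n))))
      (begin
        (A u₁ * B u₂) ^ᶠ (Q ℕ.+ 1)                  ≈⟨ x^[Q+1]≈σx*x _ ⟩
        σ (A u₁ * B u₂) * (A u₁ * B u₂)             ≈⟨ *-congʳ (σ-* _ _) ⟩
        (σ (A u₁) * σ (B u₂)) * (A u₁ * B u₂)       ≈⟨ regroup (A u₁) (B u₂) (σ (A u₁)) (σ (B u₂)) ⟩
        (A u₁ * σ (A u₁)) * (B u₂ * σ (B u₂))       ≈⟨ *-cong (A*σA≈B*σB Nu₁) (sym (A*σA≈B*σB Nu₂)) ⟩
        (B u₁ * σ (B u₁)) * (A u₂ * σ (A u₂))       ≈⟨ trans (regroup (A u₂) (B u₁) (σ (A u₂)) (σ (B u₁))) (*-comm _ _) ⟨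
        (σ (A u₂) * σ (B u₁)) * (A u₂ * B u₁)       ≈⟨ *-congʳ (σ-* _ _) ⟨
        σ (A u₂ * B u₁) * (A u₂ * B u₁)             ≈⟨ x^[Q+1]≈σx*x _ ⟨
        (A u₂ * B u₁) ^ᶠ (Q ℕ.+ 1)                  ∎)
      gcd≡1
      where
      regroup : ∀ a b sa sb → (sa * sb) * (a * b) ≈ (a * sa) * (b * sb)
      regroup = solve 4 (λ a b sa sb → (sa :* sb) :* (a :* b) := (a :* sa) :* (b :* sb)) refl

    A*B-cross⇒≈ : ∀ {u₁ u₂} → A u₁ * B u₂ ≈ A u₂ * B u₁ → u₁ ≈ u₂
    A*B-cross⇒≈ {u₁} {u₂} cross = x-y≈0⇒x≈y _ _ (x*y≈0⇒y≈0 β≉0 (*[1-σγγ]≈0⇒≈0 (begin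
      (β * (u₁ + - u₂)) * (1# + - (σ γ * γ))   ≈⟨ expand u₁ u₂ β γ (σ γ) ⟩
      A u₁ * B u₂ + - (A u₂ * B u₁)            ≈⟨ +-congʳ cross ⟩
      A u₂ * B u₁ + - (A u₂ * B u₁)            ≈⟨ -‿inverseʳ _ ⟩
      0#                                       ∎)))
      where
      expand : ∀ u₁ u₂ b g sg → (b * (u₁ + - u₂)) * (1# + - (sg * g))
             ≈ (g * u₁ + - b) * (u₂ + - (sg * b)) + - ((g * u₂ + - b) * (u₁ + - (sg * b)))
      expand = solve 5 (λ u₁ u₂ b g sg → (b :* (u₁ :- u₂)) :* (con (+ 1) :- sg :* g)
             := (g :* u₁ :- b) :* (u₂ :- sg :* b) :- (g :* u₂ :- b) :* (u₁ :- sg :* b)) refl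

    f-injective-nonzero : gcd m q ≡ 1 → gcd n (Q ℕ.+ 1) ≡ 1
                        → ∀ {x₁ x₂} → x₁ ≉ 0# → x₂ ≉ 0# → f x₁ ≈ f x₂ → x₁ ≈ x₂
    f-injective-nonzero coprime-m coprime-n {x₁} {x₂} x₁≉0 x₂≉0 fx₁≈fx₂ =
      ^-injective-coprime m q x₁≉0 x₁^m≈x₂^m u₁≈u₂ coprime-m
      where
      u₁≈u₂ : x₁ ^ᶠ q ≈ x₂ ^ᶠ q
      u₁≈u₂ = A*B-cross⇒≈ (A*B-cross (NormOne-^q x₁≉0) (NormOne-^q x₂≉0) coprime-n
                (A^n*B^n-cross _ _ (h*G-cross x₁≉0 x₂≉0 fx₁≈fx₂)))
      x₁^r≈x₂^r : x₁ ^ᶠ r ≈ x₂ ^ᶠ r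
      x₁^r≈x₂^r = *-cancelʳ (h≉0 (NormOne-^q x₁≉0)) (trans fx₁≈fx₂ (*-congˡ (h-cong (sym u₁≈u₂))))
      x₁^m≈x₂^m : x₁ ^ᶠ m ≈ x₂ ^ᶠ m
      x₁^m≈x₂^m = *-cancelʳ (^-nonzero k (^-nonzero q x₁≉0)) (begin
        x₁ ^ᶠ m * (x₁ ^ᶠ q) ^ᶠ k   ≈⟨ x^r≈x^m*[x^q]^k x₁ ⟨
        x₁ ^ᶠ r                    ≈⟨ x₁^r≈x₂^r ⟩
        x₂ ^ᶠ r                    ≈⟨ x^r≈x^m*[x^q]^k x₂ ⟩
        x₂ ^ᶠ m * (x₂ ^ᶠ q) ^ᶠ k   ≈⟨ *-congˡ (^-congˡ k (sym u₁≈u₂)) ⟩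
        x₂ ^ᶠ m * (x₁ ^ᶠ q) ^ᶠ k   ∎)

    f-injective : 0 ℕ.< n → gcd m q ≡ 1 → gcd n (Q ℕ.+ 1) ≡ 1 → ∀ a b → f a ≈ f b → a ≈ b
    f-injective 0<n coprime-m coprime-n a b fa≈fb with a ≟ 0# | b ≟ 0#
    ... | yes a≈0 | yes b≈0 = trans a≈0 (sym b≈0)
    ... | yes a≈0 | no  b≉0 = ⊥-elim (f≉0 b≉0 (trans (sym fa≈fb) (trans (f-cong a≈0) (f[0]≈0 0<n))))
    ... | no  a≉0 | yes b≈0 = ⊥-elim (f≉0 a≉0 (trans fa≈fb (trans (f-cong b≈0) (f[0]≈0 0<n))))
    ... | no  a≉0 | no  b≉0 = f-injective-nonzero coprime-m coprime-n a≉0 b≉0 fa≈fb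

    coprime⇒permutes : 0 ℕ.< n → gcd m q ≡ 1 → gcd n (Q ℕ.+ 1) ≡ 1 → Permutes F f
    coprime⇒permutes 0<n coprime-m coprime-n =
      f-injective 0<n coprime-m coprime-n , injective⇒surjective f (f-injective 0<n coprime-m coprime-n)

    -- A root of unity ζ ≉ 1 of order dividing gcd m q satisfies f ζ ≈ f 1.
    permutes⇒coprime-m : Permutes F f → gcd m q ≡ 1
    permutes⇒coprime-m (f-inj , _) with gcd m q ℕ.≟ 1
    ... | yes coprime = coprime
    ... | no  ¬coprime with ∃-rootOfUnity (gcd m q) (gcd≢1⇒2≤gcd m q (λ ()) ¬coprime) (∣-trans (gcd[m,n]∣n m q) q∣N-1)
    ...   | ζ , ζ^d≈1 , ζ≉1 = ⊥-elim (ζ≉1 (trans (sym (*-identityʳ ζ)) (f-inj (ζ * 1#) 1# (begin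
      f (ζ * 1#)       ≈⟨ f-scale 1# (x^d≈1⇒x^md≈1 _ q ζ^d≈1 (gcd[m,n]∣n m q)) ⟩
      ζ ^ᶠ m * f 1#    ≈⟨ *-congʳ (x^d≈1⇒x^md≈1 _ m ζ^d≈1 (gcd[m,n]∣m m q)) ⟩
      1# * f 1#        ≈⟨ *-identityˡ _ ⟩
      f 1#             ∎))))

    G-cong : ∀ {u v} → u ≈ v → G u ≈ G v
    G-cong u≈v = +-cong (^-congˡ n (-‿cong (B-cong u≈v))) (-‿cong (*-congˡ (^-congˡ n (-‿cong (A-cong u≈v)))))

    -- uᵥ solves the linear equation A u ≈ v * B u.
    module _ {v} (Nv : NormOne v) where

      v-γ≉0 : v + - γ ≉ 0#
      v-γ≉0 v-γ≈0 = ¬Nγ (trans (*-cong (σ-cong (sym v≈γ)) (sym v≈γ)) Nv)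
        where
        v≈γ : v ≈ γ
        v≈γ = x-y≈0⇒x≈y _ _ v-γ≈0

      ι : Carrier
      ι = (v + - γ) ⁻¹⟨ v-γ≉0 ⟩

      uᵥ : Carrier
      uᵥ = β * (v * σ γ + - 1#) * ι

      A≈v*B : A uᵥ ≈ v * B uᵥ
      A≈v*B = x-y≈0⇒x≈y _ _ (begin
        A uᵥ + - (v * B uᵥ)                  ≈⟨ expand v γ (σ γ) β ι ⟩
        β * (v * σ γ + - 1#) * (1# + - ((v + - γ) * ι))
                                             ≈⟨ *-congˡ (trans (+-congˡ (-‿cong (x*x⁻¹≈1 _ v-γ≉0))) (-‿inverseʳ 1#)) ⟩
        β * (v * σ γ + - 1#) * 0#            ≈⟨ zeroʳ _ ⟩
        0#                                   ∎)
        where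
        expand : ∀ v g sg b i → (g * (b * (v * sg + - 1#) * i) + - b) + - (v * ((b * (v * sg + - 1#) * i) + - (sg * b)))
               ≈ b * (v * sg + - 1#) * (1# + - ((v + - g) * i))
        expand = solve 5 (λ v g sg b i →
            (g :* (b :* (v :* sg :- con (+ 1)) :* i) :- b) :- v :* ((b :* (v :* sg :- con (+ 1)) :* i) :- sg :* b)
          := b :* (v :* sg :- con (+ 1)) :* (con (+ 1) :- (v :- g) :* i)) refl

      NormOne-uᵥ : NormOne uᵥ
      NormOne-uᵥ = begin
        σ uᵥ * uᵥ
          ≈⟨ *-congʳ (trans (σ-* _ _) (*-congʳ (trans (σ-* _ _) (*-congˡ σW)))) ⟩
        (σ β * (σ v * γ + - 1#) * σ ι) * (β * (v * σ γ + - 1#) * ι)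
          ≈⟨ expand (σ β) β v (σ v) γ (σ γ) (σ ι) ι ⟩
        (σ β * β) * (((σ v + - σ γ) * σ ι) * ((v + - γ) * ι) + ((σ γ * γ + - 1#) * (σ v * v + - 1#)) * (σ ι * ι))
          ≈⟨ *-cong Nβ (+-cong (*-cong σ[v-γ]σι≈1 (x*x⁻¹≈1 _ v-γ≉0)) (*-congʳ (*-congˡ (trans (+-congʳ Nv) (-‿inverseʳ 1#))))) ⟩
        1# * (1# * 1# + ((σ γ * γ + - 1#) * 0#) * (σ ι * ι))
          ≈⟨ simplify (σ γ * γ + - 1#) (σ ι * ι) ⟩
        1# ∎
        where
        σW : σ (v * σ γ + - 1#) ≈ σ v * γ + - 1#
        σW = trans (σ-+ _ _) (+-cong (trans (σ-* _ _) (*-congˡ (σ-involutive γ))) (trans (σ-neg _) (-‿cong σ-1)))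
        σ[v-γ]σι≈1 : (σ v + - σ γ) * σ ι ≈ 1#
        σ[v-γ]σι≈1 = begin
          (σ v + - σ γ) * σ ι    ≈⟨ *-congʳ (trans (σ-+ _ _) (+-congˡ (σ-neg γ))) ⟨
          σ (v + - γ) * σ ι      ≈⟨ σ-* _ _ ⟨
          σ ((v + - γ) * ι)      ≈⟨ σ-cong (x*x⁻¹≈1 _ v-γ≉0) ⟩
          σ 1#                   ≈⟨ σ-1 ⟩
          1#                     ∎
        expand : ∀ sb b v sv g sg si i → (sb * (sv * g + - 1#) * si) * (b * (v * sg + - 1#) * i)
               ≈ (sb * b) * (((sv + - sg) * si) * ((v + - g) * i) + ((sg * g + - 1#) * (sv * v + - 1#)) * (si * i))
        expand = solve 8 (λ sb b v sv g sg si i →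
            (sb :* (sv :* g :- con (+ 1)) :* si) :* (b :* (v :* sg :- con (+ 1)) :* i)
          := (sb :* b) :* (((sv :- sg) :* si) :* ((v :- g) :* i)
                           :+ ((sg :* g :- con (+ 1)) :* (sv :* v :- con (+ 1))) :* (si :* i))) refl
        simplify : ∀ a b → 1# * (1# * 1# + (a * 0#) * b) ≈ 1#
        simplify = solve 2 (λ a b → con (+ 1) :* (con (+ 1) :* con (+ 1) :+ (a :* con (+ 0)) :* b) := con (+ 1)) refl

      module _ (v^n≈1 : v ^ᶠ n ≈ 1#) where

        h[uᵥ]≈ : h uᵥ ≈ B uᵥ ^ᶠ n * (1# + - γ)
        h[uᵥ]≈ = begin
          A uᵥ ^ᶠ n + - (γ * B uᵥ ^ᶠ n)               ≈⟨ +-congʳ (trans (^-congˡ n A≈v*B) (^-distrib-* v _ n)) ⟩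
          v ^ᶠ n * B uᵥ ^ᶠ n + - (γ * B uᵥ ^ᶠ n)      ≈⟨ +-congʳ (*-congʳ v^n≈1) ⟩
          1# * B uᵥ ^ᶠ n + - (γ * B uᵥ ^ᶠ n)          ≈⟨ factor (B uᵥ ^ᶠ n) γ ⟩
          B uᵥ ^ᶠ n * (1# + - γ)                      ∎
          where
          factor : ∀ b g → 1# * b + - (g * b) ≈ b * (1# + - g)
          factor = solve 2 (λ b g → con (+ 1) :* b :- g :* b := b :* (con (+ 1) :- g)) refl

        G[uᵥ]≈ : G uᵥ ≈ (- 1#) ^ᶠ n * B uᵥ ^ᶠ n * (1# + - σ γ)
        G[uᵥ]≈ = begin
          (- B uᵥ) ^ᶠ n + - (σ γ * (- A uᵥ) ^ᶠ n)     ≈⟨ +-congˡ (-‿cong (*-congˡ (^-congˡ n (-‿cong A≈v*B)))) ⟩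
          (- B uᵥ) ^ᶠ n + - (σ γ * (- (v * B uᵥ)) ^ᶠ n) ≈⟨ +-congˡ (-‿cong (*-congˡ (^-congˡ n (-‿distribʳ-* v _)))) ⟩
          (- B uᵥ) ^ᶠ n + - (σ γ * (v * - B uᵥ) ^ᶠ n) ≈⟨ +-congˡ (-‿cong (*-congˡ (trans (^-distrib-* v _ n) (trans (*-congʳ v^n≈1) (*-identityˡ _))))) ⟩
          (- B uᵥ) ^ᶠ n + - (σ γ * (- B uᵥ) ^ᶠ n)     ≈⟨ factor ((- B uᵥ) ^ᶠ n) (σ γ) ⟩
          (- B uᵥ) ^ᶠ n * (1# + - σ γ)               ≈⟨ *-congʳ (trans (^-congˡ n (sym (-1*x≈-x _))) (^-distrib-* (- 1#) _ n)) ⟩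
          (- 1#) ^ᶠ n * B uᵥ ^ᶠ n * (1# + - σ γ)     ∎
          where
          factor : ∀ b g → b + - (g * b) ≈ b * (1# + - g)
          factor = solve 2 (λ b g → b :- g :* b := b :* (con (+ 1) :- g)) refl

        σf≈f-on-fibre : ∀ {x} → x ≉ 0# → x ^ᶠ q ≈ uᵥ
                      → (β ^ᶠ n * (1# + - γ)) * σ (f x) ≈ ((- 1#) ^ᶠ n * (1# + - σ γ)) * f x
        σf≈f-on-fibre {x} x≉0 x^q≈uᵥ = begin
          (β ^ᶠ n * c₁) * σ (f x)          ≈⟨ swap-σf ⟩
          (β ^ᶠ n * σ (f x)) * c₁          ≈⟨ *-congʳ (trans (β^n*σf≈x^r*G x≉0) (*-congˡ (trans (G-cong x^q≈uᵥ) G[uᵥ]≈))) ⟩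
          (x ^ᶠ r * (s * b * c₂)) * c₁     ≈⟨ regroup (x ^ᶠ r) s b c₁ c₂ ⟩
          (s * c₂) * (x ^ᶠ r * (b * c₁))   ≈⟨ *-congˡ (*-congˡ (trans (sym h[uᵥ]≈) (h-cong (sym x^q≈uᵥ)))) ⟩
          (s * c₂) * f x                   ∎
          where
          s = (- 1#) ^ᶠ n
          b = B uᵥ ^ᶠ n
          c₁ = 1# + - γ
          c₂ = 1# + - σ γ
          swap-σf : (β ^ᶠ n * c₁) * σ (f x) ≈ (β ^ᶠ n * σ (f x)) * c₁
          swap-σf = trans (*-assoc _ _ _) (trans (*-congˡ (*-comm _ _)) (sym (*-assoc _ _ _)))
          regroup : ∀ X s b c₁ c₂ → (X * (s * b * c₂)) * c₁ ≈ (s * c₂) * (X * (b * c₁))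
          regroup = solve 5 (λ X s b c₁ c₂ → (X :* (s :* b :* c₂)) :* c₁ := (s :* c₂) :* (X :* (b :* c₁))) refl

    1-γ≉0 : 1# + - γ ≉ 0#
    1-γ≉0 1-γ≈0 = ¬Nγ (trans (*-cong (σ-cong (sym 1≈γ)) (sym 1≈γ)) (trans (*-identityʳ _) σ-1))
      where
      1≈γ : 1# ≈ γ
      1≈γ = x-y≈0⇒x≈y _ _ 1-γ≈0

    -- The images of x₁ and x₂ differ by a factor ω with ω ^ q ≈ 1, and ω ≈ t ^ m with
    -- t ^ q ≈ 1, so f (t * x₂) ≈ f x₁.
    σ-relation⇒same-^q : (∀ a b → f a ≈ f b → a ≈ b) → gcd m q ≡ 1
      → ∀ {κ μ x₁ x₂} → κ ≉ 0# → x₁ ≉ 0# → x₂ ≉ 0#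
      → κ * σ (f x₁) ≈ μ * f x₁ → κ * σ (f x₂) ≈ μ * f x₂ → x₁ ^ᶠ q ≈ x₂ ^ᶠ q
    σ-relation⇒same-^q f-inj coprime-m {κ} {μ} {x₁} {x₂} κ≉0 x₁≉0 x₂≉0 rel₁ rel₂ =
      fromRoot (∃-root-coprime m q ω≉0 ω^q≈1 coprime-m)
      where
      y₁≉0 = f≉0 x₁≉0
      y₂≉0 = f≉0 x₂≉0
      ω = f x₁ * f x₂ ⁻¹⟨ y₂≉0 ⟩
      ω*y₂≈y₁ : ω * f x₂ ≈ f x₁
      ω*y₂≈y₁ = trans (*-assoc _ _ _) (trans (*-congˡ (trans (*-comm _ _) (x*x⁻¹≈1 _ y₂≉0))) (*-identityʳ _))
      ω≉0 : ω ≉ 0#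
      ω≉0 ω≈0 = y₁≉0 (trans (sym ω*y₂≈y₁) (trans (*-congʳ ω≈0) (zeroˡ _)))
      ω^q≈1 : ω ^ᶠ q ≈ 1#
      ω^q≈1 = *-cancelʳ (^-nonzero q y₂≉0) (begin
        ω ^ᶠ q * f x₂ ^ᶠ q    ≈⟨ ^-distrib-* ω (f x₂) q ⟨
        (ω * f x₂) ^ᶠ q       ≈⟨ ^-congˡ q ω*y₂≈y₁ ⟩
        f x₁ ^ᶠ q             ≈⟨ σ-ratio⇒^q≈ κ≉0 y₁≉0 y₂≉0 rel₁ rel₂ ⟩
        f x₂ ^ᶠ q             ≈⟨ *-identityˡ _ ⟨
        1# * f x₂ ^ᶠ q        ∎)
      fromRoot : (∃ λ t → t ^ᶠ q ≈ 1# × t ^ᶠ m ≈ ω) → x₁ ^ᶠ q ≈ x₂ ^ᶠ q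
      fromRoot (t , t^q≈1 , t^m≈ω) = begin
        x₁ ^ᶠ q          ≈⟨ ^-congˡ q (f-inj _ _ f[tx₂]≈f[x₁]) ⟨
        (t * x₂) ^ᶠ q    ≈⟨ x^s≈1⇒[x*y]^s≈y^s x₂ q t^q≈1 ⟩
        x₂ ^ᶠ q          ∎
        where
        f[tx₂]≈f[x₁] : f (t * x₂) ≈ f x₁
        f[tx₂]≈f[x₁] = trans (f-scale x₂ t^q≈1) (trans (*-congʳ t^m≈ω) ω*y₂≈y₁)

    -- The fibres over u₁ and u_ζ contain points x₁, x_ζ whose images satisfy the same
    -- σ-relation, so u₁ ≈ u_ζ; comparing A u ≈ v * B u for v = 1 and v = ζ gives ζ ≈ 1.
    permutes⇒rootOfUnity≈1 : Permutes F f → ∀ {ζ} → NormOne ζ → ζ ^ᶠ n ≈ 1# → ζ ≈ 1#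
    permutes⇒rootOfUnity≈1 perm@(f-inj , _) {ζ} Nζ ζ^n≈1 = sym (*-cancelʳ (B≉0 (NormOne-uᵥ N1)) (begin
      1# * B u₁   ≈⟨ A≈v*B N1 ⟨
      A u₁        ≈⟨ A-cong u₁≈u₂ ⟩
      A u₂        ≈⟨ A≈v*B Nζ ⟩
      ζ * B u₂    ≈⟨ *-congˡ (B-cong u₁≈u₂) ⟨
      ζ * B u₁    ∎))
      where
      N1 : NormOne 1#
      N1 = trans (*-identityʳ _) σ-1
      u₁ = uᵥ N1
      u₂ = uᵥ Nζ
      fibre₁ = hilbert90 (NormOne-uᵥ N1)
      fibre₂ = hilbert90 (NormOne-uᵥ Nζ)
      κ≉0 : β ^ᶠ n * (1# + - γ) ≉ 0#
      κ≉0 = *-nonzero (^-nonzero n β≉0) 1-γ≉0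
      u₁≈u₂ : u₁ ≈ u₂
      u₁≈u₂ = begin
        u₁                     ≈⟨ proj₂ (proj₂ fibre₁) ⟨
        proj₁ fibre₁ ^ᶠ q      ≈⟨ σ-relation⇒same-^q f-inj (permutes⇒coprime-m perm) κ≉0
                                    (proj₁ (proj₂ fibre₁)) (proj₁ (proj₂ fibre₂))
                                    (σf≈f-on-fibre N1 (1^m≈1 n) (proj₁ (proj₂ fibre₁)) (proj₂ (proj₂ fibre₁)))
                                    (σf≈f-on-fibre Nζ ζ^n≈1 (proj₁ (proj₂ fibre₂)) (proj₂ (proj₂ fibre₂))) ⟩
        proj₁ fibre₂ ^ᶠ q      ≈⟨ proj₂ (proj₂ fibre₂) ⟩
        u₂                     ∎

    permutes⇒coprime-n : Permutes F f → gcd n (Q ℕ.+ 1) ≡ 1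
    permutes⇒coprime-n perm with gcd n (Q ℕ.+ 1) ℕ.≟ 1
    ... | yes coprime  = coprime
    ... | no  ¬coprime = ⊥-elim (noRoot (∃-rootOfUnity d (gcd≢1⇒2≤gcd n (Q ℕ.+ 1) (λ ()) ¬coprime)
                                                         (∣-trans (gcd[m,n]∣n n (Q ℕ.+ 1)) Q+1∣N-1)))
      where
      d = gcd n (Q ℕ.+ 1)
      noRoot : (∃ λ ζ → ζ ^ᶠ d ≈ 1# × ζ ≉ 1#) → ⊥
      noRoot (ζ , ζ^d≈1 , ζ≉1) = ζ≉1 (permutes⇒rootOfUnity≈1 perm
        (trans (sym (x^[Q+1]≈σx*x ζ)) (x^d≈1⇒x^md≈1 d (Q ℕ.+ 1) ζ^d≈1 (gcd[m,n]∣n n (Q ℕ.+ 1))))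
        (x^d≈1⇒x^md≈1 d n ζ^d≈1 (gcd[m,n]∣m n (Q ℕ.+ 1))))

open import Data.Nat using (_+_; _*_)

theorem1p1 : ∀ {c ℓ : Level} (Q : ℕ) → IsPrimePower Q → (F : FiniteField c ℓ (Q ^ 2))
    → (n k : ℕ) → n > 0
    → (β γ : FiniteField.Carrier F)
    → FiniteField._≈_ F (FiniteField._^ᶠ_ F β (Q + 1)) (FiniteField.1# F)
    → ¬ (FiniteField._≈_ F (FiniteField._^ᶠ_ F γ (Q + 1)) (FiniteField.1# F))
    → Permutes F (fPoly F Q n k β γ) ⇔ (gcd (n + 2 * k) (Q ∸ 1) ≡ 1 × gcd n (Q + 1) ≡ 1)
theorem1p1 zero          _ F _ _ _ _ _ _ _ = ⊥-elim (ℕ.≤⇒≯ (FiniteFieldProperties.2≤N F) (s≤s z≤n))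
theorem1p1 (suc zero)    _ F _ _ _ _ _ _ _ = ⊥-elim (ℕ.≤⇒≯ (FiniteFieldProperties.2≤N F) (s≤s (s≤s z≤n)))
theorem1p1 (suc (suc q′)) (p , e , p-prime , _ , Q≡p^e) F n k 0<n β γ β^[Q+1]≈1 γ^[Q+1]≉1 =
  mk⇔ (λ perm → permutes⇒coprime-m perm , permutes⇒coprime-n perm)
      (λ (coprime-m , coprime-n) → coprime⇒permutes 0<n coprime-m coprime-n)
  where
  open Conjugation q′ F {e = e} p-prime Q≡p^e
  open Polynomial n k β γ (trans (sym (x^[Q+1]≈σx*x β)) β^[Q+1]≈1)
                          (λ Nγ → γ^[Q+1]≉1 (trans (x^[Q+1]≈σx*x γ) Nγ))
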